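{- Let $\mathcal P$ be a finite classical polar space of rank $d>2$, let $t$ be an even integer with $d\ge 2t\ge0$, let $Y$ be a $(d,t)$-EKR set of generators, and let $a_1,a_2,a_3\in Y$. Put $\ell_{ij}=a_i\cap a_j$, $P=a_1\cap a_2\cap a_3$ and $U=\langle\ell_{12},\ell_{13},\ell_{23}\rangle$. Then: (a) $\dim(P)\ge d-\frac32t$. (b) If $\dim(P)=d-\frac32t$, then (i) $\dim(U)=d$; (ii) $\dim(\ell_{ij})=d-t$ for $1\le i<j\le3$; (iii) $\dim(a_i\cap U)=d-\frac t2$ and $a_i\cap U=\langle\ell_{ij},\ell_{ik}\rangle$ for $\{i,j,k\}=\{1,2,3\}$; (iv) every $b\in Y$ satisfies $\dim(b\cap U)\ge d-\frac t2$ or $\dim(b\cap P)>d-2t$.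
   Context: Finite classical polar spaces ($Q^\pm$, $Q$, $H$, $W$): the totally isotropic (totally singular) subspaces of a non-degenerate form; generators are the maximal ones, of vector space dimension $d$ (rank). A $(d,t)$-EKR set is a set $Y$ of generators with $d-\dim(y_1\cap y_2)\le t$ for all $y_1,y_2\in Y$. All dimensions are vector space dimensions; $\langle\cdot\rangle$ denotes span. -}

module Defs where

open import Level using (0ℓ)
open import Data.Nat using (ℕ; zero; suc)
open import Data.Fin using (Fin; zero; suc)
open import Data.Product using (Σ; ∃; _×_; _,_)
open import Relation.Nullary using (¬_)
open import Relation.Binary using (Decidable)
open import Algebra.Bundles using (CommutativeRing)

record FiniteField : Set₁ where
  field
    commRing : CommutativeRing 0ℓ 0ℓ
  open CommutativeRing commRing public
  field
    _≟_      : Decidable _≈_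
    0≉1      : ¬ (0# ≈ 1#)
    inverse  : ∀ x → ¬ (x ≈ 0#) → ∃ λ y → x * y ≈ 1#
    card     : ℕ
    enum     : Fin card → Carrier
    enum-surj : ∀ x → ∃ λ i → enum i ≈ x

module Over (F : FiniteField) (n : ℕ) where
  open FiniteField F using (Carrier; _≈_; _+_; _*_; _-_; 0#; 1#)

  V : Set
  V = Fin n → Carrier

  _≈V_ : V → V → Set
  x ≈V y = ∀ i → x i ≈ y i

  0V : V
  0V _ = 0#

  _+V_ : V → V → V
  (x +V y) i = x i + y i

  _•_ : Carrier → V → V
  (a • x) i = a * x i

  Subspace : Set₁
  Subspace = V → Set

  record IsSubspace (S : Subspace) : Set where
    field
      resp  : ∀ {x y} → x ≈V y → S x → S y
      zero∈ : S 0V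
      +-closed : ∀ {x y} → S x → S y → S (x +V y)
      •-closed : ∀ a {x} → S x → S (a • x)

  _⊆_ : Subspace → Subspace → Set
  A ⊆ B = ∀ x → A x → B x

  _≐_ : Subspace → Subspace → Set
  A ≐ B = A ⊆ B × B ⊆ A

  _∩_ : Subspace → Subspace → Subspace
  (A ∩ B) x = A x × B x

  ⟨_,_⟩ : Subspace → Subspace → Subspace
  ⟨ A , B ⟩ x = Σ V λ u → Σ V λ v → A u × B v × x ≈V (u +V v)

  ⟨_,_,_⟩ : Subspace → Subspace → Subspace → Subspace
  ⟨ A , B , C ⟩ x = Σ V λ u → Σ V λ v → Σ V λ w →
                      A u × B v × C w × x ≈V ((u +V v) +V w)

  lincomb : ∀ {k} → (Fin k → Carrier) → (Fin k → V) → V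
  lincomb {zero}  c b = 0V
  lincomb {suc k} c b = (c zero • b zero) +V lincomb (λ i → c (suc i)) (λ i → b (suc i))

  LinIndep : ∀ {k} → (Fin k → V) → Set
  LinIndep b = ∀ c → lincomb c b ≈V 0V → ∀ i → c i ≈ 0#

  HasDim : Subspace → ℕ → Set
  HasDim S k = Σ (Fin k → V) λ b →
                 (∀ i → S (b i)) × LinIndep b ×
                 (∀ x → S x → ∃ λ c → x ≈V lincomb c b)

  record IsSesquilinear (σ : Carrier → Carrier) (f : V → V → Carrier) : Set where
    field
      cong : ∀ {x x' y y'} → x ≈V x' → y ≈V y' → f x y ≈ f x' y'
      linˡ : ∀ a x y z → f ((a • x) +V y) z ≈ (a * f x z) + f y z
      linʳ : ∀ a x y z → f x ((a • y) +V z) ≈ (σ a * f x y) + f x z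

  NonDegenerate : (V → V → Carrier) → Set
  NonDegenerate f = ∀ x → (∀ y → f x y ≈ 0#) → x ≈V 0V

  record IsInvolution (σ : Carrier → Carrier) : Set where
    field
      cong  : ∀ {a b} → a ≈ b → σ a ≈ σ b
      hom+  : ∀ a b → σ (a + b) ≈ σ a + σ b
      hom*  : ∀ a b → σ (a * b) ≈ σ a * σ b
      hom1  : σ 1# ≈ 1#
      invol : ∀ a → σ (σ a) ≈ a
      nontrivial : ∃ λ a → ¬ (σ a ≈ a)

  polar : (V → Carrier) → V → V → Carrier
  polar q x y = q (x +V y) - q x - q y

  record IsQuadraticForm (q : V → Carrier) : Set where
    field
      cong   : ∀ {x y} → x ≈V y → q x ≈ q y
      scale  : ∀ a x → q (a • x) ≈ (a * a) * q x
      polar-bilinear : IsSesquilinear (λ a → a) (polar q)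

  NonSingular : (V → Carrier) → Set
  NonSingular q = ∀ x → q x ≈ 0# → (∀ y → polar q x y ≈ 0#) → x ≈V 0V

  data PolarSpace : Set where
    symplectic : (f : V → V → Carrier) → IsSesquilinear (λ a → a) f →
                 (∀ x → f x x ≈ 0#) → NonDegenerate f → PolarSpace
    hermitian  : (σ : Carrier → Carrier) → IsInvolution σ →
                 (f : V → V → Carrier) → IsSesquilinear σ f →
                 (∀ x y → f y x ≈ σ (f x y)) → NonDegenerate f → PolarSpace
    quadric    : (q : V → Carrier) → IsQuadraticForm q → NonSingular q → PolarSpace

  TotallyIsotropic : PolarSpace → Subspace → Set
  TotallyIsotropic (symplectic f _ _ _)  S = ∀ x y → S x → S y → f x y ≈ 0#
  TotallyIsotropic (hermitian _ _ f _ _ _) S = ∀ x y → S x → S y → f x y ≈ 0#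
  TotallyIsotropic (quadric q _ _)         S = ∀ x → S x → q x ≈ 0#

  record IsTISubspace (𝒫 : PolarSpace) (S : Subspace) : Set where
    field
      subspace : IsSubspace S
      isotropic : TotallyIsotropic 𝒫 S

  record Generator (𝒫 : PolarSpace) (S : Subspace) : Set₁ where
    field
      ti : IsTISubspace 𝒫 S
      maximal : ∀ T → IsTISubspace 𝒫 T → S ⊆ T → T ⊆ S

  HasRank : PolarSpace → ℕ → Set₁
  HasRank 𝒫 d = ∀ S → Generator 𝒫 S → HasDim S d

  DimAtLeast : Subspace → ℕ → Set
  DimAtLeast S m = ∃ λ k → HasDim S k × m Data.Nat.≤ k

  DimGreater : Subspace → ℕ → Set
  DimGreater S m = ∃ λ k → HasDim S k × m Data.Nat.< k

  IsEKR : PolarSpace → ℕ → ℕ → (Subspace → Set) → Set₁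
  IsEKR 𝒫 d t Y = (∀ y → Y y → Generator 𝒫 y) ×
                  (∀ y₁ y₂ → Y y₁ → Y y₂ →
                     ∃ λ k → HasDim (y₁ ∩ y₂) k × d Data.Nat.≤ k Data.Nat.+ t)

-- Extend a basis of P = a₁ ∩ a₂ ∩ a₃ to bases of the three lines ℓᵢⱼ = aᵢ ∩ aⱼ.
-- Any two lines meet only in P, so the union of these bases is independent; it
-- spans U, which is totally isotropic because any two of the ℓᵢⱼ lie in a common
-- generator aᵢ, hence dim U ≤ d.  As dim ℓᵢⱼ ≥ d − t (EKR) and
-- Σ dim ℓᵢⱼ = dim U + 2 dim P ≤ d + 2 dim P, we get dim P ≥ d − 3t/2, and in the
-- extremal case every inequality is an equality, which gives (i)–(iii); the
-- description of aᵢ ∩ U is the modular law.  For (iv) the same construction is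
-- applied to b ∩ P and the b ∩ ℓᵢⱼ: if dim (b ∩ P) ≤ d − 2t then, by (a) for
-- the triples (b, aᵢ, aⱼ), the resulting independent family in b ∩ U has at
-- least 3(d − 3t/2) − 2(d − 2t) = d − t/2 members.
-- Everything is constructive because the field is finite: membership in a span
-- and isotropy are decided by enumerating coefficient vectors.

module Submission where

open import Data.Nat using (ℕ)
open import Defs

-- h stands for t/2, so the EKR condition reads d ≤ dim (aᵢ ∩ aⱼ) + h * 2.
module Arithmetic {d h : ℕ} where
  open import Data.Nat
  open import Data.Nat.Properties
  open import Data.Product using (_×_; _,_)
  open import Relation.Binary.PropositionalEquality
  open import Data.Nat.Solver using (module +-*-Solver)
  open +-*-Solver using (solve; _:=_; _:+_; _:*_; con)

  open ≤-Reasoning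

  d≤p+3h : ∀ {p m₁ m₂ m₃} →
           d ≤ m₁ + p + h * 2 → d ≤ m₂ + p + h * 2 → d ≤ m₃ + p + h * 2 →
           m₃ + (m₂ + (m₁ + p)) ≤ d → d ≤ p + 3 * h
  d≤p+3h {p} {m₁} {m₂} {m₃} b₁ b₂ b₃ total = *-cancelˡ-≤ 2 (+-cancelˡ-≤ d _ _ (begin
    d + 2 * d                                              ≡⟨ solve 1 (λ d → d :+ con 2 :* d := d :+ d :+ d) refl d ⟩
    d + d + d                                              ≤⟨ +-mono-≤ (+-mono-≤ b₁ b₂) b₃ ⟩
    (m₁ + p + h * 2) + (m₂ + p + h * 2) + (m₃ + p + h * 2) ≡⟨ regroup ⟩
    m₃ + (m₂ + (m₁ + p)) + 2 * (p + 3 * h)                 ≤⟨ +-monoˡ-≤ _ total ⟩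
    d + 2 * (p + 3 * h)                                    ∎))
    where
    regroup : (m₁ + p + h * 2) + (m₂ + p + h * 2) + (m₃ + p + h * 2) ≡ m₃ + (m₂ + (m₁ + p)) + 2 * (p + 3 * h)
    regroup = solve 5 (λ h p m₁ m₂ m₃ →
                (m₁ :+ p :+ h :* con 2) :+ (m₂ :+ p :+ h :* con 2) :+ (m₃ :+ p :+ h :* con 2)
                := m₃ :+ (m₂ :+ (m₁ :+ p)) :+ con 2 :* (p :+ con 3 :* h)) refl h p m₁ m₂ m₃

  h≤m : ∀ {p m} → p + 3 * h ≤ d → d ≤ m + p + h * 2 → h ≤ m
  h≤m {p} {m} p+3h≤d b = +-cancelˡ-≤ (p + h * 2) h m (begin
    p + h * 2 + h  ≡⟨ solve 2 (λ h p → p :+ h :* con 2 :+ h := p :+ con 3 :* h) refl h p ⟩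
    p + 3 * h      ≤⟨ p+3h≤d ⟩
    d              ≤⟨ b ⟩
    m + p + h * 2  ≡⟨ +-comm (m + p) (h * 2) ⟩
    h * 2 + (m + p) ≡⟨ solve 3 (λ h p m → h :* con 2 :+ (m :+ p) := p :+ h :* con 2 :+ m) refl h p m ⟩
    p + h * 2 + m  ∎)

  m≤h : ∀ {x y z} → h ≤ y → h ≤ z → x + (y + z) ≤ 3 * h → x ≤ h
  m≤h {x} {y} {z} h≤y h≤z total = +-cancelʳ-≤ (h + h) x h (begin
    x + (h + h) ≤⟨ +-monoʳ-≤ x (+-mono-≤ h≤y h≤z) ⟩
    x + (y + z) ≤⟨ total ⟩
    3 * h       ≡⟨ solve 1 (λ h → con 3 :* h := h :+ (h :+ h)) refl h ⟩
    h + (h + h) ∎)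

  extremal : ∀ {p m₁ m₂ m₃} → p + 3 * h ≤ d →
             d ≤ m₁ + p + h * 2 → d ≤ m₂ + p + h * 2 → d ≤ m₃ + p + h * 2 →
             m₃ + (m₂ + (m₁ + p)) ≤ d →
             d ≡ p + 3 * h × m₁ ≡ h × m₂ ≡ h × m₃ ≡ h
  extremal {p} {m₁} {m₂} {m₃} p+3h≤d b₁ b₂ b₃ total =
      d≡p+3h
    , ≤-antisym (m≤h h≤m₂ h≤m₃ (permuted (solve 3 (λ a b c → a :+ (b :+ c) := c :+ (b :+ a)) refl m₁ m₂ m₃))) h≤m₁
    , ≤-antisym (m≤h h≤m₁ h≤m₃ (permuted (solve 3 (λ a b c → b :+ (a :+ c) := c :+ (b :+ a)) refl m₁ m₂ m₃))) h≤m₂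
    , ≤-antisym (m≤h h≤m₁ h≤m₂ (permuted (solve 3 (λ a b c → c :+ (a :+ b) := c :+ (b :+ a)) refl m₁ m₂ m₃))) h≤m₃
    where
    d≡p+3h : d ≡ p + 3 * h
    d≡p+3h = ≤-antisym (d≤p+3h {p} b₁ b₂ b₃ total) p+3h≤d
    h≤m₁ : h ≤ m₁
    h≤m₁ = h≤m {p} p+3h≤d b₁
    h≤m₂ : h ≤ m₂
    h≤m₂ = h≤m {p} p+3h≤d b₂
    h≤m₃ : h ≤ m₃
    h≤m₃ = h≤m {p} p+3h≤d b₃
    sum≤3h : m₃ + (m₂ + m₁) ≤ 3 * h
    sum≤3h = +-cancelˡ-≤ p _ _ (begin
      p + (m₃ + (m₂ + m₁)) ≡⟨ solve 4 (λ p m₁ m₂ m₃ → p :+ (m₃ :+ (m₂ :+ m₁)) := m₃ :+ (m₂ :+ (m₁ :+ p))) refl p m₁ m₂ m₃ ⟩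
      m₃ + (m₂ + (m₁ + p)) ≤⟨ total ⟩
      d                    ≡⟨ d≡p+3h ⟩
      p + 3 * h            ∎)
    permuted : ∀ {s} → s ≡ m₃ + (m₂ + m₁) → s ≤ 3 * h
    permuted s≡ = ≤-trans (≤-reflexive s≡) sum≤3h

  d∸h≤ : ∀ {q m₁ m₂ m₃} → q + 2 * (h * 2) ≤ d →
         d ≤ m₁ + q + 3 * h → d ≤ m₂ + q + 3 * h → d ≤ m₃ + q + 3 * h →
         d ∸ h ≤ m₃ + (m₂ + (m₁ + q))
  d∸h≤ {q} {m₁} {m₂} {m₃} q+4h≤d b₁ b₂ b₃ = m≤n+o⇒m∸n≤o d h (+-cancelˡ-≤ (K + K) _ _ (begin
    K + K + d                                        ≤⟨ +-monoˡ-≤ d (+-mono-≤ q+4h≤d q+4h≤d) ⟩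
    d + d + d                                        ≤⟨ +-mono-≤ (+-mono-≤ b₁ b₂) b₃ ⟩
    (m₁ + q + 3 * h) + (m₂ + q + 3 * h) + (m₃ + q + 3 * h) ≡⟨ regroup ⟩
    K + K + (h + (m₃ + (m₂ + (m₁ + q))))             ∎))
    where
    K : ℕ
    K = q + 2 * (h * 2)
    regroup : (m₁ + q + 3 * h) + (m₂ + q + 3 * h) + (m₃ + q + 3 * h) ≡ K + K + (h + (m₃ + (m₂ + (m₁ + q))))
    regroup = solve 5 (λ h q m₁ m₂ m₃ →
                (m₁ :+ q :+ con 3 :* h) :+ (m₂ :+ q :+ con 3 :* h) :+ (m₃ :+ q :+ con 3 :* h)
                := (q :+ con 2 :* (h :* con 2)) :+ (q :+ con 2 :* (h :* con 2)) :+ (h :+ (m₃ :+ (m₂ :+ (m₁ :+ q)))))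
                refl h q m₁ m₂ m₃


  3h≤4h : 3 * h ≤ 2 * (h * 2)
  3h≤4h = ≤-trans (m≤m+n (3 * h) h) (≤-reflexive (solve 1 (λ h → con 3 :* h :+ h := con 2 :* (h :* con 2)) refl h))

  module _ {p} (d≡p+3h : d ≡ p + 3 * h) where

    span-size : ∀ {m₁ m₂ m₃} → m₁ ≡ h → m₂ ≡ h → m₃ ≡ h → m₃ + (m₂ + (m₁ + p)) ≡ d
    span-size refl refl refl = trans (solve 2 (λ h p → h :+ (h :+ (h :+ p)) := p :+ con 3 :* h) refl h p) (sym d≡p+3h)

    pair-size : ∀ {m} → m ≡ h → m + p ≡ d ∸ h * 2
    pair-size refl = sym (trans (cong (_∸ h * 2) (trans d≡p+3h (solve 2 (λ h p → p :+ con 3 :* h := h :+ p :+ h :* con 2) refl h p)))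
                                (m+n∸n≡m (h + p) (h * 2)))

    flag-size : ∀ {m m′} → m ≡ h → m′ ≡ h → m + (m′ + p) ≡ d ∸ h
    flag-size refl refl = sym (trans (cong (_∸ h) (trans d≡p+3h (solve 2 (λ h p → p :+ con 3 :* h := h :+ (h :+ p) :+ h) refl h p)))
                                     (m+n∸n≡m (h + (h + p)) h))

module VectorFamilies {A : Set} where
  open import Function using (_∘_)
  open import Data.Fin using (suc; splitAt; _↑ˡ_; _↑ʳ_)
  open import Data.Fin.Properties using (join-splitAt)
  open import Data.Nat as ℕ using (suc)
  open import Data.Sum using (inj₁; inj₂)
  open import Data.Sum.Properties using ([,]-map; [,]-∘)
  open import Data.Vec.Functional using (Vector; _++_; tail)
  open import Relation.Binary.PropositionalEquality using (_≡_; sym; trans; cong)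

  tail-++ : ∀ {m k} (e : Vector A (suc m)) (g : Vector A k) i → (e ++ g) (suc i) ≡ (tail e ++ g) i
  tail-++ {m} e g i = [,]-map (splitAt m i)

  ++-split : ∀ {m k} (e : Vector A (m ℕ.+ k)) i → e i ≡ ((e ∘ (_↑ˡ k)) ++ (e ∘ (m ↑ʳ_))) i
  ++-split {m} {k} e i = trans (cong e (sym (join-splitAt m k i))) ([,]-∘ e (splitAt m i))

  ++-all : ∀ (P : A → Set) {m k} (e : Vector A m) (g : Vector A k) →
           (∀ i → P (e i)) → (∀ i → P (g i)) → ∀ i → P ((e ++ g) i)
  ++-all P {m} e g Pe Pg i with splitAt m i
  ... | inj₁ j = Pe j
  ... | inj₂ j = Pg j


module LinearAlgebra (F : FiniteField) (n : ℕ) where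
  open import Level using (0ℓ)
  open import Function using (_∘_)
  open import Data.Empty using (⊥-elim)
  open import Data.Fin using (Fin; zero; suc; punchIn; _↑ˡ_; _↑ʳ_)
  open import Data.Fin.Properties using (any?; all?)
  open import Data.Nat as ℕ using (zero; suc)
  import Data.Nat.Properties as ℕ
  open import Data.Product using (Σ; ∃; _×_; _,_; proj₁; proj₂; map₂)
  open import Data.Sum using (_⊎_; inj₁; inj₂)
  open import Data.Vec.Functional using (Vector; _∷_; _++_; tail; insertAt)
  open import Data.Vec.Functional.Properties using (lookup-++ˡ; lookup-++ʳ; insertAt-punchIn)
  open import Relation.Nullary using (¬_; Dec; yes; no; ¬?; _×-dec_)
  open import Relation.Nullary.Decidable using (decidable-stable)
  import Relation.Unary as U
  open import Relation.Unary.Properties using (_∩?_)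
  open import Relation.Binary.Bundles using (Setoid)
  open import Relation.Binary.PropositionalEquality as ≡ using (_≡_)
  import Relation.Binary.Reasoning.Setoid as SetoidReasoning
  open VectorFamilies
  open FiniteField F hiding (zero) renaming (_≟_ to _≟F_)
  open Over F n
  open import Algebra.Properties.Ring ring using (-1*x≈-x; -‿distribˡ-*; -0#≈0#)
  open import Algebra.Properties.CommutativeSemigroup +-commutativeSemigroup using (interchange)

  ≈V-refl : ∀ {x} → x ≈V x
  ≈V-refl i = refl

  ≈V-sym : ∀ {x y} → x ≈V y → y ≈V x
  ≈V-sym p i = sym (p i)

  ≈V-trans : ∀ {x y z} → x ≈V y → y ≈V z → x ≈V z
  ≈V-trans p q i = trans (p i) (q i)

  ≡⇒≈V : ∀ {x y} → x ≡ y → x ≈V y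
  ≡⇒≈V ≡.refl = ≈V-refl

  V-setoid : Setoid 0ℓ 0ℓ
  V-setoid = record
    { Carrier = V ; _≈_ = _≈V_
    ; isEquivalence = record { refl = ≈V-refl ; sym = ≈V-sym ; trans = ≈V-trans } }

  module ≈V-Reasoning = SetoidReasoning V-setoid

  +V-cong : ∀ {x x′ y y′} → x ≈V x′ → y ≈V y′ → (x +V y) ≈V (x′ +V y′)
  +V-cong p q i = +-cong (p i) (q i)

  •-cong : ∀ {a b x y} → a ≈ b → x ≈V y → (a • x) ≈V (b • y)
  •-cong p q i = *-cong p (q i)

  +V-assoc : ∀ x y z → ((x +V y) +V z) ≈V (x +V (y +V z))
  +V-assoc x y z i = +-assoc (x i) (y i) (z i)

  +V-comm : ∀ x y → (x +V y) ≈V (y +V x)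
  +V-comm x y i = +-comm (x i) (y i)

  +V-identityˡ : ∀ x → (0V +V x) ≈V x
  +V-identityˡ x i = +-identityˡ (x i)

  +V-identityʳ : ∀ x → (x +V 0V) ≈V x
  +V-identityʳ x i = +-identityʳ (x i)

  +V-interchange : ∀ x y z w → ((x +V y) +V (z +V w)) ≈V ((x +V z) +V (y +V w))
  +V-interchange x y z w i = interchange (x i) (y i) (z i) (w i)

  •-distribˡ : ∀ a x y → (a • (x +V y)) ≈V ((a • x) +V (a • y))
  •-distribˡ a x y i = distribˡ a (x i) (y i)

  •-distribʳ : ∀ a b x → ((a + b) • x) ≈V ((a • x) +V (b • x))
  •-distribʳ a b x i = distribʳ (x i) a b

  •-assoc : ∀ a b x → ((a * b) • x) ≈V (a • (b • x))
  •-assoc a b x i = *-assoc a b (x i)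

  •-identityˡ : ∀ x → (1# • x) ≈V x
  •-identityˡ x i = *-identityˡ (x i)

  •-zeroˡ : ∀ x → (0# • x) ≈V 0V
  •-zeroˡ x i = zeroˡ (x i)

  •-zeroʳ : ∀ a → (a • 0V) ≈V 0V
  •-zeroʳ a i = zeroʳ a

  +V-swapʳ : ∀ x y z → ((x +V y) +V z) ≈V ((x +V z) +V y)
  +V-swapʳ x y z = ≈V-trans (+V-assoc x y z) (≈V-trans (+V-cong ≈V-refl (+V-comm y z)) (≈V-sym (+V-assoc x z y)))

  infixl 6 _-V_
  _-V_ : V → V → V
  x -V y = x +V ((- 1#) • y)

  -V-inverseʳ : ∀ x → (x -V x) ≈V 0V
  -V-inverseʳ x i = trans (+-cong refl (-1*x≈-x (x i))) (-‿inverseʳ (x i))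

  x≈y+z⇒z≈x-y : ∀ {x y z} → x ≈V (y +V z) → z ≈V (x -V y)
  x≈y+z⇒z≈x-y {x} {y} {z} p i = sym (R.begin
    x i + (- 1#) * y i  R.≈⟨ +-cong (p i) (-1*x≈-x (y i)) ⟩
    (y i + z i) - y i   R.≈⟨ +-cong (+-comm (y i) (z i)) refl ⟩
    (z i + y i) - y i   R.≈⟨ +-assoc (z i) (y i) (- y i) ⟩
    z i + (y i - y i)   R.≈⟨ +-cong refl (-‿inverseʳ (y i)) ⟩
    z i + 0#            R.≈⟨ +-identityʳ (z i) ⟩
    z i                 R.∎)
    where module R = SetoidReasoning setoid

  lincomb-cong : ∀ {k} {c c′ : Vector Carrier k} {b b′ : Vector V k} →
                 (∀ i → c i ≈ c′ i) → (∀ i → b i ≈V b′ i) → lincomb c b ≈V lincomb c′ b′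
  lincomb-cong {zero}  p q = ≈V-refl
  lincomb-cong {suc k} p q = +V-cong (•-cong (p zero) (q zero)) (lincomb-cong (p ∘ suc) (q ∘ suc))

  lincomb-zero : ∀ {k} {c : Vector Carrier k} (b : Vector V k) → (∀ i → c i ≈ 0#) → lincomb c b ≈V 0V
  lincomb-zero {zero}  b p = ≈V-refl
  lincomb-zero {suc k} b p = ≈V-trans (+V-cong (≈V-trans (•-cong (p zero) ≈V-refl) (•-zeroˡ (b zero)))
                                               (lincomb-zero (b ∘ suc) (p ∘ suc)))
                                      (+V-identityˡ 0V)

  lincomb-+ᶜ : ∀ {k} (c c′ : Vector Carrier k) (b : Vector V k) →
               lincomb (λ i → c i + c′ i) b ≈V (lincomb c b +V lincomb c′ b)
  lincomb-+ᶜ {zero}  c c′ b = ≈V-sym (+V-identityˡ 0V)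
  lincomb-+ᶜ {suc k} c c′ b = ≈V-trans (+V-cong (•-distribʳ (c zero) (c′ zero) (b zero))
                                                (lincomb-+ᶜ (c ∘ suc) (c′ ∘ suc) (b ∘ suc)))
                                       (+V-interchange _ _ _ _)

  lincomb-*ᶜ : ∀ {k} a (c : Vector Carrier k) (b : Vector V k) →
               lincomb (λ i → a * c i) b ≈V (a • lincomb c b)
  lincomb-*ᶜ {zero}  a c b = ≈V-sym (•-zeroʳ a)
  lincomb-*ᶜ {suc k} a c b = ≈V-trans (+V-cong (•-assoc a (c zero) (b zero)) (lincomb-*ᶜ a (c ∘ suc) (b ∘ suc)))
                                      (≈V-sym (•-distribˡ a _ _))

  lincomb-+ᵛ : ∀ {k} (c : Vector Carrier k) (u w : Vector V k) →
               lincomb c (λ i → u i +V w i) ≈V (lincomb c u +V lincomb c w)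
  lincomb-+ᵛ {zero}  c u w = ≈V-sym (+V-identityˡ 0V)
  lincomb-+ᵛ {suc k} c u w = ≈V-trans (+V-cong (•-distribˡ (c zero) (u zero) (w zero))
                                               (lincomb-+ᵛ (c ∘ suc) (u ∘ suc) (w ∘ suc)))
                                      (+V-interchange _ _ _ _)

  lincomb-•ᵛ : ∀ {k} (c s : Vector Carrier k) (w : Vector V k) →
               lincomb c (λ i → s i • w i) ≈V lincomb (λ i → c i * s i) w
  lincomb-•ᵛ {zero}  c s w = ≈V-refl
  lincomb-•ᵛ {suc k} c s w = +V-cong (≈V-sym (•-assoc (c zero) (s zero) (w zero)))
                                     (lincomb-•ᵛ (c ∘ suc) (s ∘ suc) (w ∘ suc))

  sum : ∀ {k} → Vector Carrier k → Carrier
  sum {zero}  c = 0#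
  sum {suc k} c = c zero + sum (c ∘ suc)

  lincomb-const : ∀ {k} (c : Vector Carrier k) (v : V) → lincomb c (λ _ → v) ≈V (sum c • v)
  lincomb-const {zero}  c v = ≈V-sym (•-zeroˡ v)
  lincomb-const {suc k} c v = ≈V-trans (+V-cong ≈V-refl (lincomb-const (c ∘ suc) v))
                                       (≈V-sym (•-distribʳ _ _ v))

  lincomb-++ : ∀ {m k} (c : Vector Carrier m) (c′ : Vector Carrier k) (e : Vector V m) (g : Vector V k) →
               lincomb (c ++ c′) (e ++ g) ≈V (lincomb c e +V lincomb c′ g)
  lincomb-++ {zero}  c c′ e g = ≈V-sym (+V-identityˡ _)
  lincomb-++ {suc m} c c′ e g = ≈V-trans
    (+V-cong ≈V-refl (≈V-trans (lincomb-cong (reflexive ∘ tail-++ c c′) (≡⇒≈V ∘ tail-++ e g))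
                               (lincomb-++ (tail c) c′ (tail e) g)))
    (≈V-sym (+V-assoc _ _ _))

  lincomb-insertAt : ∀ {k} (c : Vector Carrier k) (j : Fin (suc k)) s (b : Vector V (suc k)) →
                     lincomb (insertAt c j s) b ≈V ((s • b j) +V lincomb c (b ∘ punchIn j))
  lincomb-insertAt c zero s b = ≈V-refl
  lincomb-insertAt {suc k} c (suc j) s b = begin
    (c zero • b zero) +V lincomb (insertAt (tail c) j s) (tail b)
      ≈⟨ +V-cong ≈V-refl (lincomb-insertAt (tail c) j s (tail b)) ⟩
    (c zero • b zero) +V ((s • b (suc j)) +V _) ≈⟨ +V-assoc _ _ _ ⟨
    ((c zero • b zero) +V (s • b (suc j))) +V _ ≈⟨ +V-cong (+V-comm _ _) ≈V-refl ⟩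
    ((s • b (suc j)) +V (c zero • b zero)) +V _ ≈⟨ +V-assoc _ _ _ ⟩
    (s • b (suc j)) +V ((c zero • b zero) +V _) ∎
    where open ≈V-Reasoning

  δ : ∀ {k} → Fin k → Fin k → Carrier
  δ zero    zero    = 1#
  δ zero    (suc i) = 0#
  δ (suc j) zero    = 0#
  δ (suc j) (suc i) = δ j i

  lincomb-δ : ∀ {k} (b : Vector V k) j → b j ≈V lincomb (δ j) b
  lincomb-δ {suc k} b zero = ≈V-sym (≈V-trans (+V-cong (•-identityˡ (b zero)) (lincomb-zero (tail b) (λ _ → refl)))
                                              (+V-identityʳ _))
  lincomb-δ {suc k} b (suc j) = ≈V-trans (lincomb-δ (tail b) j)
                                         (≈V-sym (≈V-trans (+V-cong (•-zeroˡ (b zero)) ≈V-refl) (+V-identityˡ _)))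

  Span : ∀ {k} → Vector V k → Subspace
  Span g x = ∃ λ c → x ≈V lincomb c g

  Span-isSubspace : ∀ {k} (g : Vector V k) → IsSubspace (Span g)
  Span-isSubspace g = record
    { resp     = λ { p (c , q) → c , ≈V-trans (≈V-sym p) q }
    ; zero∈    = (λ _ → 0#) , ≈V-sym (lincomb-zero g (λ _ → refl))
    ; +-closed = λ { (c , p) (c′ , q) → (λ i → c i + c′ i) , ≈V-trans (+V-cong p q) (≈V-sym (lincomb-+ᶜ c c′ g)) }
    ; •-closed = λ a → λ { (c , p) → (λ i → a * c i) , ≈V-trans (•-cong refl p) (≈V-sym (lincomb-*ᶜ a c g)) } }

  lincomb-∈ : ∀ {S k} → IsSubspace S → (g : Vector V k) → (∀ i → S (g i)) → ∀ c → S (lincomb c g)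
  lincomb-∈ {k = zero}  sS g gS c = IsSubspace.zero∈ sS
  lincomb-∈ {k = suc k} sS g gS c = IsSubspace.+-closed sS (IsSubspace.•-closed sS (c zero) (gS zero))
                                                          (lincomb-∈ sS (tail g) (gS ∘ suc) (c ∘ suc))

  Span-least : ∀ {S k} → IsSubspace S → (g : Vector V k) → (∀ i → S (g i)) → Span g ⊆ S
  Span-least sS g gS x (c , p) = IsSubspace.resp sS (≈V-sym p) (lincomb-∈ sS g gS c)

  ∈-Span : ∀ {k} (g : Vector V k) j → Span g (g j)
  ∈-Span g j = δ j , lincomb-δ g j

  Span-mono : ∀ {k m} (g : Vector V k) (h : Vector V m) → (∀ i → Span h (g i)) → Span g ⊆ Span h
  Span-mono g h = Span-least (Span-isSubspace h) g

  ∈-Span-++ˡ : ∀ {m k} (e : Vector V m) (g : Vector V k) i → Span (e ++ g) (e i)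
  ∈-Span-++ˡ {k = k} e g i = ≡.subst (Span (e ++ g)) (lookup-++ˡ e g i) (∈-Span (e ++ g) (i ↑ˡ k))

  ∈-Span-++ʳ : ∀ {m k} (e : Vector V m) (g : Vector V k) i → Span (e ++ g) (g i)
  ∈-Span-++ʳ {m} e g i = ≡.subst (Span (e ++ g)) (lookup-++ʳ e g i) (∈-Span (e ++ g) (m ↑ʳ i))

  Span-resp : ∀ {k} {g g′ : Vector V k} → (∀ i → g i ≈V g′ i) → Span g′ ⊆ Span g
  Span-resp p x (c , q) = c , ≈V-trans q (lincomb-cong (λ _ → refl) (≈V-sym ∘ p))

  ∈-difference : ∀ {S x y z} → IsSubspace S → x ≈V (y +V z) → S x → S y → S z
  ∈-difference sS x≈y+z Sx Sy =
    IsSubspace.resp sS (≈V-sym (x≈y+z⇒z≈x-y x≈y+z)) (IsSubspace.+-closed sS Sx (IsSubspace.•-closed sS (- 1#) Sy))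

  •-Span-cancel : ∀ {k} {g : Vector V k} {a x} → ¬ a ≈ 0# → Span g (a • x) → Span g x
  •-Span-cancel {g = g} {a} {x} a≉0 ax∈ with inverse a a≉0
  ... | a⁻¹ , aa⁻¹≈1 = IsSubspace.resp (Span-isSubspace g) a⁻¹ax≈x (IsSubspace.•-closed (Span-isSubspace g) a⁻¹ ax∈)
    where
    a⁻¹ax≈x : (a⁻¹ • (a • x)) ≈V x
    a⁻¹ax≈x = ≈V-trans (≈V-sym (•-assoc a⁻¹ a x))
                       (≈V-trans (•-cong (trans (*-comm a⁻¹ a) aa⁻¹≈1) ≈V-refl) (•-identityˡ x))

  LinIndep-resp : ∀ {k} {b b′ : Vector V k} → (∀ i → b i ≈V b′ i) → LinIndep b → LinIndep b′
  LinIndep-resp b≈b′ ind c p = ind c (≈V-trans (lincomb-cong (λ _ → refl) b≈b′) p)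

  ∷-independent : ∀ {k} {g : Vector V k} {x} → LinIndep g → ¬ Span g x → LinIndep (x ∷ g)
  ∷-independent {g = g} {x} ind x∉ c p = coefficients≈0
    where
    c₀x∈ : Span g (c zero • x)
    c₀x∈ = ∈-difference (Span-isSubspace g) (≈V-trans (≈V-sym p) (+V-comm _ _))
                        (IsSubspace.zero∈ (Span-isSubspace g)) (c ∘ suc , ≈V-refl)
    c₀≈0 : c zero ≈ 0#
    c₀≈0 = decidable-stable (c zero ≟F 0#) (λ c₀≉0 → x∉ (•-Span-cancel c₀≉0 c₀x∈))
    coefficients≈0 : ∀ i → c i ≈ 0#
    coefficients≈0 zero    = c₀≈0
    coefficients≈0 (suc i) = ind (c ∘ suc) tail≈0 i
      where
      tail≈0 : lincomb (c ∘ suc) (tail (x ∷ g)) ≈V 0V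
      tail≈0 = ≈V-trans (≈V-sym (+V-identityˡ _))
                        (≈V-trans (+V-cong (≈V-sym (≈V-trans (•-cong c₀≈0 ≈V-refl) (•-zeroˡ x))) ≈V-refl) p)

  lincomb-split : ∀ {m k} (C : Vector Carrier (m ℕ.+ k)) (e : Vector V m) (g : Vector V k) →
                  lincomb C (e ++ g) ≈V (lincomb (C ∘ (_↑ˡ k)) e +V lincomb (C ∘ (m ↑ʳ_)) g)
  lincomb-split {m} C e g = ≈V-trans (lincomb-cong (reflexive ∘ ++-split {m = m} C) (λ _ → ≈V-refl)) (lincomb-++ _ _ e g)

  ++-zero : ∀ {m k} (C : Vector Carrier (m ℕ.+ k)) →
            (∀ j → C (j ↑ˡ k) ≈ 0#) → (∀ j → C (m ↑ʳ j) ≈ 0#) → ∀ i → C i ≈ 0#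
  ++-zero {m} C left right i =
    ≡.subst (_≈ 0#) (≡.sym (++-split {m = m} C i)) (++-all (_≈ 0#) (C ∘ (_↑ˡ _)) (C ∘ (m ↑ʳ_)) left right i)

  ++-independent : ∀ {m k p} (e : Vector V m) (g : Vector V k) (z : Vector V p) →
                   LinIndep g → LinIndep (e ++ z) → (∀ w → Span e w → Span g w → Span z w) →
                   LinIndep (e ++ g)
  ++-independent {m} {k} {p} e g z g-ind ez-ind meet C C≈0 = ++-zero C c≈0 c′≈0
    where
    c : Vector Carrier m
    c = C ∘ (_↑ˡ k)
    c′ : Vector Carrier k
    c′ = C ∘ (m ↑ʳ_)
    sum≈0 : (lincomb c e +V lincomb c′ g) ≈V 0V
    sum≈0 = ≈V-trans (≈V-sym (lincomb-split C e g)) C≈0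
    inZ : Span z (lincomb c e)
    inZ = meet _ (c , ≈V-refl) (∈-difference (Span-isSubspace g) (≈V-trans (≈V-sym sum≈0) (+V-comm _ _))
                                             (IsSubspace.zero∈ (Span-isSubspace g)) (c′ , ≈V-refl))
    d : Vector Carrier p
    d = proj₁ inZ
    c≈0 : ∀ j → c j ≈ 0#
    c≈0 j = ≡.subst (_≈ 0#) (lookup-++ˡ c _ j) (ez-ind (c ++ (λ l → - 1# * d l)) cancel (j ↑ˡ p))
      where
      open ≈V-Reasoning
      cancel : lincomb (c ++ (λ l → - 1# * d l)) (e ++ z) ≈V 0V
      cancel = begin
        lincomb (c ++ (λ l → - 1# * d l)) (e ++ z)  ≈⟨ lincomb-++ c _ e z ⟩
        lincomb c e +V lincomb (λ l → - 1# * d l) z ≈⟨ +V-cong ≈V-refl (lincomb-*ᶜ (- 1#) d z) ⟩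
        lincomb c e +V ((- 1#) • lincomb d z)       ≈⟨ +V-cong ≈V-refl (•-cong refl (≈V-sym (proj₂ inZ))) ⟩
        lincomb c e -V lincomb c e                  ≈⟨ -V-inverseʳ _ ⟩
        0V                                          ∎
    c′≈0 : ∀ j → c′ j ≈ 0#
    c′≈0 = g-ind c′ (≈V-trans (≈V-sym (+V-identityˡ _))
                              (≈V-trans (+V-cong (≈V-sym (lincomb-zero e c≈0)) ≈V-refl) sum≈0))

  lincomb-∷-zero : ∀ {k} {a : Carrier} (c : Vector Carrier k) (x : V) (g : Vector V k) →
                   a ≈ 0# → lincomb (a ∷ c) (x ∷ g) ≈V lincomb c g
  lincomb-∷-zero c x g a≈0 = ≈V-trans (+V-cong (≈V-trans (•-cong a≈0 ≈V-refl) (•-zeroˡ x)) ≈V-refl) (+V-identityˡ _)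

  -- Steinitz exchange: subtracting multiples of the pivot b j clears the first
  -- coordinate of the other vectors.
  eliminate-pivot : ∀ {m k} (a : Vector V (suc m)) (b : Vector V (suc k)) → LinIndep b →
                    (sp : ∀ i → Span a (b i)) (j : Fin (suc k)) → ¬ proj₁ (sp j) zero ≈ 0# →
                    Σ (Vector V k) λ b′ → LinIndep b′ × (∀ i → Span (tail a) (b′ i))
  eliminate-pivot {m} {k} a b b-ind sp j γⱼ≉0 with inverse (proj₁ (sp j) zero) γⱼ≉0
  ... | y , γⱼy≈1 = b′ , b′-ind , b′∈
    where
    γ : Fin (suc k) → Vector Carrier (suc m)
    γ i = proj₁ (sp i)
    μ : Vector Carrier k
    μ i = - (γ (punchIn j i) zero * y)
    b′ : Vector V k
    b′ i = b (punchIn j i) +V (μ i • b j)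
    κ : Fin k → Vector Carrier (suc m)
    κ i l = γ (punchIn j i) l + μ i * γ j l
    κ₀≈0 : ∀ i → κ i zero ≈ 0#
    κ₀≈0 i = begin
      γ (punchIn j i) zero + - (γ (punchIn j i) zero * y) * γ j zero ≈⟨ +-cong refl (-‿distribˡ-* _ _) ⟨
      γ (punchIn j i) zero - (γ (punchIn j i) zero * y) * γ j zero   ≈⟨ +-cong refl (-‿cong (*-assoc _ _ _)) ⟩
      γ (punchIn j i) zero - γ (punchIn j i) zero * (y * γ j zero)   ≈⟨ +-cong refl (-‿cong (*-cong refl (trans (*-comm _ _) γⱼy≈1))) ⟩
      γ (punchIn j i) zero - γ (punchIn j i) zero * 1#               ≈⟨ +-cong refl (-‿cong (*-identityʳ _)) ⟩
      γ (punchIn j i) zero - γ (punchIn j i) zero                    ≈⟨ -‿inverseʳ _ ⟩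
      0#                                                             ∎
      where open SetoidReasoning setoid
    b′∈ : ∀ i → Span (tail a) (b′ i)
    b′∈ i = tail (κ i) , (begin
      b′ i                                                 ≈⟨ +V-cong (proj₂ (sp (punchIn j i))) (•-cong refl (proj₂ (sp j))) ⟩
      lincomb (γ (punchIn j i)) a +V (μ i • lincomb (γ j) a) ≈⟨ +V-cong ≈V-refl (lincomb-*ᶜ (μ i) (γ j) a) ⟨
      lincomb (γ (punchIn j i)) a +V lincomb (λ l → μ i * γ j l) a ≈⟨ lincomb-+ᶜ (γ (punchIn j i)) (λ l → μ i * γ j l) a ⟨
      lincomb (κ i) a                                      ≈⟨ lincomb-∷-zero (tail (κ i)) (a zero) (tail a) (κ₀≈0 i) ⟩
      lincomb (tail (κ i)) (tail a)                        ∎)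
      where open ≈V-Reasoning
    b′-ind : LinIndep b′
    b′-ind c c≈0 i = ≡.subst (_≈ 0#) (insertAt-punchIn c j s i) (b-ind (insertAt c j s) lifted (punchIn j i))
      where
      s : Carrier
      s = sum (λ i → c i * μ i)
      open ≈V-Reasoning
      lifted : lincomb (insertAt c j s) b ≈V 0V
      lifted = begin
        lincomb (insertAt c j s) b                             ≈⟨ lincomb-insertAt c j s b ⟩
        (s • b j) +V lincomb c (b ∘ punchIn j)                 ≈⟨ +V-comm _ _ ⟩
        lincomb c (b ∘ punchIn j) +V (s • b j)                 ≈⟨ +V-cong ≈V-refl (lincomb-const (λ i → c i * μ i) (b j)) ⟨
        lincomb c (b ∘ punchIn j) +V lincomb (λ i → c i * μ i) (λ _ → b j) ≈⟨ +V-cong ≈V-refl (lincomb-•ᵛ c μ (λ _ → b j)) ⟨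
        lincomb c (b ∘ punchIn j) +V lincomb c (λ i → μ i • b j) ≈⟨ lincomb-+ᵛ c _ _ ⟨
        lincomb c b′                                           ≈⟨ c≈0 ⟩
        0V                                                     ∎

  independent-≤ : ∀ m {k} (a : Vector V m) (b : Vector V k) → LinIndep b → (∀ i → Span a (b i)) → k ℕ.≤ m
  independent-≤ zero    {zero}  a b b-ind sp = ℕ.z≤n
  independent-≤ zero    {suc k} a b b-ind sp = ⊥-elim (0≉1 (sym (b-ind (δ zero) (≈V-trans (≈V-sym (lincomb-δ b zero)) (proj₂ (sp zero))) zero)))
  independent-≤ (suc m) {k} a b b-ind sp with any? (λ i → ¬? (proj₁ (sp i) zero ≟F 0#))
  independent-≤ (suc m) {suc k} a b b-ind sp | yes (j , γⱼ≉0) with eliminate-pivot a b b-ind sp j γⱼ≉0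
  ... | b′ , b′-ind , b′∈ = ℕ.s≤s (independent-≤ m (tail a) b′ b′-ind b′∈)
  independent-≤ (suc m) a b b-ind sp | no ¬pivot = ℕ.m≤n⇒m≤1+n (independent-≤ m (tail a) b b-ind b∈)
    where
    b∈ : ∀ i → Span (tail a) (b i)
    b∈ i = tail (proj₁ (sp i)) ,
           ≈V-trans (proj₂ (sp i)) (lincomb-∷-zero _ (a zero) (tail a)
                    (decidable-stable (_ ≟F 0#) (λ γᵢ≉0 → ¬pivot (i , γᵢ≉0))))

  stdBasis : Vector V n
  stdBasis j = δ j

  lincomb-apply : ∀ {k} (c : Vector Carrier k) (b : Vector V k) l → lincomb c b l ≈ sum (λ i → c i * b i l)
  lincomb-apply {zero}  c b l = refl
  lincomb-apply {suc k} c b l = +-cong refl (lincomb-apply (c ∘ suc) (tail b) l)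

  sum-zero : ∀ {k} (c : Vector Carrier k) → (∀ i → c i ≈ 0#) → sum c ≈ 0#
  sum-zero {zero}  c p = refl
  sum-zero {suc k} c p = trans (+-cong (p zero) (sum-zero (c ∘ suc) (p ∘ suc))) (+-identityʳ 0#)

  sum-δ : ∀ {k} (x : Vector Carrier k) l → sum (λ i → x i * δ i l) ≈ x l
  sum-δ {suc k} x zero    = trans (+-cong (*-identityʳ _) (sum-zero _ (λ i → zeroʳ (x (suc i))))) (+-identityʳ _)
  sum-δ {suc k} x (suc l) = trans (+-cong (zeroʳ _) (sum-δ (x ∘ suc) l)) (+-identityˡ _)

  Span-stdBasis : ∀ x → Span stdBasis x
  Span-stdBasis x = x , λ l → sym (trans (lincomb-apply x stdBasis l) (sum-δ x l))

  independent-≤-n : ∀ {k} (b : Vector V k) → LinIndep b → k ℕ.≤ n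
  independent-≤-n b b-ind = independent-≤ n stdBasis b b-ind (Span-stdBasis ∘ b)

  Respects≈ : ∀ {k} → (Vector Carrier k → Set) → Set
  Respects≈ {k} Q = ∀ {c c′ : Vector Carrier k} → (∀ i → c i ≈ c′ i) → Q c → Q c′

  any-vector? : ∀ k (Q : Vector Carrier k → Set) → Respects≈ Q → (∀ c → Dec (Q c)) → Dec (∃ Q)
  any-vector? zero Q resp Q? with Q? (λ ())
  ... | yes q = yes ((λ ()) , q)
  ... | no ¬q = no λ { (c , q) → ¬q (resp (λ ()) q) }
  any-vector? (suc k) Q resp Q?
    with any? (λ i → any-vector? k (λ c → Q (enum i ∷ c))
                                   (λ p → resp λ { zero → refl ; (suc l) → p l })
                                   (λ c → Q? (enum i ∷ c)))
  ... | yes (i , c , q) = yes (enum i ∷ c , q)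
  ... | no ¬q = no λ { (c , q) → ¬q (proj₁ (enum-surj (c zero)) , tail c ,
                                     resp (λ { zero → sym (proj₂ (enum-surj (c zero))) ; (suc l) → refl }) q) }

  all-vectors? : ∀ k (Q : Vector Carrier k → Set) → Respects≈ Q → (∀ c → Dec (Q c)) → Dec (∀ c → Q c)
  all-vectors? k Q resp Q? with any-vector? k (¬_ ∘ Q) (λ p ¬q q → ¬q (resp (sym ∘ p) q)) (¬? ∘ Q?)
  ... | yes (c , ¬q) = no λ all → ¬q (all c)
  ... | no ¬counterexample = yes λ c → decidable-stable (Q? c) (λ ¬q → ¬counterexample (c , ¬q))

  _≈V?_ : ∀ x y → Dec (x ≈V y)
  x ≈V? y = all? (λ i → x i ≟F y i)

  Span? : ∀ {k} (g : Vector V k) x → Dec (Span g x)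
  Span? {k} g x = any-vector? k (λ c → x ≈V lincomb c g)
                              (λ p q → ≈V-trans q (lincomb-cong p (λ _ → ≈V-refl))) (λ c → x ≈V? lincomb c g)

  -- A family with more than n members is dependent, so n steps suffice.
  module Greedy (Q R : ∀ {k} → Vector V k → Set)
                (Q-resp : ∀ {k} {g g′ : Vector V k} → (∀ i → g i ≈V g′ i) → Q g → Q g′)
                (step : ∀ {k} (g : Vector V k) → Q g → (Σ V λ x → ¬ Span g x × Q (x ∷ g)) ⊎ R g) where

    ∷-++ : ∀ {m k} (x : V) (e : Vector V m) (g : Vector V k) i → ((x ∷ e) ++ g) i ≈V (x ∷ (e ++ g)) i
    ∷-++ x e g zero    = ≈V-refl
    ∷-++ x e g (suc i) = ≡⇒≈V (tail-++ (x ∷ e) g i)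

    grow : ∀ fuel {k m} (g : Vector V k) (e : Vector V m) → n ℕ.≤ fuel ℕ.+ (m ℕ.+ k) →
           Q (e ++ g) → LinIndep (e ++ g) →
           Σ ℕ λ m′ → Σ (Vector V m′) λ e′ → Q (e′ ++ g) × LinIndep (e′ ++ g) × R (e′ ++ g)
    grow fuel g e bound q ind with step (e ++ g) q
    ... | inj₂ r = _ , e , q , ind , r
    grow zero {k} {m} g e bound q ind | inj₁ (x , x∉ , qx) =
      ⊥-elim (ℕ.<-irrefl ≡.refl (ℕ.≤-trans (independent-≤-n (x ∷ (e ++ g)) (∷-independent ind x∉)) bound))
    grow (suc fuel) {k} {m} g e bound q ind | inj₁ (x , x∉ , qx) =
      grow fuel g (x ∷ e) (≡.subst (n ℕ.≤_) (≡.sym (ℕ.+-suc fuel (m ℕ.+ k))) bound)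
           (Q-resp (≈V-sym ∘ ∷-++ x e g) qx)
           (LinIndep-resp (≈V-sym ∘ ∷-++ x e g) (∷-independent ind x∉))

    extend : ∀ {k} (g : Vector V k) → Q g → LinIndep g →
             Σ ℕ λ m′ → Σ (Vector V m′) λ e′ → Q (e′ ++ g) × LinIndep (e′ ++ g) × R (e′ ++ g)
    extend {k} g q ind = grow n g (λ ()) (ℕ.m≤m+n n k) q ind

  IsBasis : ∀ {k} → Subspace → Vector V k → Set
  IsBasis S b = (∀ i → S (b i)) × LinIndep b × S ⊆ Span b

  ∩-isSubspace : ∀ {A B} → IsSubspace A → IsSubspace B → IsSubspace (A ∩ B)
  ∩-isSubspace sA sB = record
    { resp     = λ p (a , b) → IsSubspace.resp sA p a , IsSubspace.resp sB p b
    ; zero∈    = IsSubspace.zero∈ sA , IsSubspace.zero∈ sB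
    ; +-closed = λ (a , b) (a′ , b′) → IsSubspace.+-closed sA a a′ , IsSubspace.+-closed sB b b′
    ; •-closed = λ c (a , b) → IsSubspace.•-closed sA c a , IsSubspace.•-closed sB c b }

  module _ {S} (S-sub : IsSubspace S) (S? : U.Decidable S) where

    private
      add-vector : ∀ {k} (g : Vector V k) → (∀ i → S (g i)) →
                   (Σ V λ x → ¬ Span g x × (∀ i → S ((x ∷ g) i))) ⊎ S ⊆ Span g
      add-vector g g∈ with any-vector? n (λ x → S x × ¬ Span g x)
                             (λ p (x∈ , x∉) → IsSubspace.resp S-sub p x∈ ,
                                               x∉ ∘ IsSubspace.resp (Span-isSubspace g) (≈V-sym p))
                             (λ x → S? x ×-dec ¬? (Span? g x))
      ... | yes (x , x∈ , x∉) = inj₁ (x , x∉ , λ { zero → x∈ ; (suc i) → g∈ i })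
      ... | no ∄x = inj₂ λ x x∈ → decidable-stable (Span? g x) (λ x∉ → ∄x (x , x∈ , x∉))

      module Basis = Greedy (λ g → ∀ i → S (g i)) (λ g → S ⊆ Span g)
                            (λ p g∈ i → IsSubspace.resp S-sub (p i) (g∈ i)) add-vector

    extend-to-basis : ∀ {k} (g : Vector V k) → (∀ i → S (g i)) → LinIndep g →
                      Σ ℕ λ m → Σ (Vector V m) λ e → IsBasis S (e ++ g)
    extend-to-basis = Basis.extend

    ∃-dim : ∃ (HasDim S)
    ∃-dim with extend-to-basis {0} (λ ()) (λ ()) (λ _ _ ())
    ... | m , e , basis = m ℕ.+ 0 , e ++ (λ ()) , basis

  independent⇒DimAtLeast : ∀ {S k m} → IsSubspace S → U.Decidable S → (g : Vector V k) →
                           (∀ i → S (g i)) → LinIndep g → m ℕ.≤ k → DimAtLeast S m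
  independent⇒DimAtLeast {k = k} S-sub S? g g∈ g-ind m≤k with extend-to-basis S-sub S? g g∈ g-ind
  ... | l , e , basis = l ℕ.+ k , (e ++ g , basis) , ℕ.≤-trans m≤k (ℕ.m≤n+m k l)

  HasDim⇒Decidable : ∀ {S k} → IsSubspace S → HasDim S k → U.Decidable S
  HasDim⇒Decidable S-sub (b , b∈ , _ , b-spans) x with Span? b x
  ... | yes x∈ = yes (Span-least S-sub b b∈ x x∈)
  ... | no x∉  = no (x∉ ∘ b-spans x)

  independent-≤-dim : ∀ {S k m} → HasDim S k → (h : Vector V m) → LinIndep h → (∀ i → S (h i)) → m ℕ.≤ k
  independent-≤-dim {k = k} (b , _ , _ , b-spans) h h-ind h∈ = independent-≤ k b h h-ind (λ i → b-spans (h i) (h∈ i))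

  TotallyIsotropic-⊆ : ∀ 𝒫 {A B} → A ⊆ B → TotallyIsotropic 𝒫 B → TotallyIsotropic 𝒫 A
  TotallyIsotropic-⊆ (symplectic _ _ _ _)    A⊆B iso x y x∈ y∈ = iso x y (A⊆B x x∈) (A⊆B y y∈)
  TotallyIsotropic-⊆ (hermitian _ _ _ _ _ _) A⊆B iso x y x∈ y∈ = iso x y (A⊆B x x∈) (A⊆B y y∈)
  TotallyIsotropic-⊆ (quadric _ _ _)         A⊆B iso x x∈     = iso x (A⊆B x x∈)

  module _ {σ} {f : V → V → Carrier} (f-sesq : IsSesquilinear σ f) where
    open IsSesquilinear f-sesq

    Span-isotropic? : ∀ {k} (g : Vector V k) → Dec (∀ x y → Span g x → Span g y → f x y ≈ 0#)
    Span-isotropic? {k} g with all-vectors? k (λ c → ∀ c′ → f (lincomb c g) (lincomb c′ g) ≈ 0#)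
                                 (λ p iso c′ → trans (cong (lincomb-cong (sym ∘ p) (λ _ → ≈V-refl)) ≈V-refl) (iso c′))
                                 (λ c → all-vectors? k (λ c′ → f (lincomb c g) (lincomb c′ g) ≈ 0#)
                                          (λ p iso → trans (cong ≈V-refl (lincomb-cong (sym ∘ p) (λ _ → ≈V-refl))) iso)
                                          (λ c′ → f (lincomb c g) (lincomb c′ g) ≟F 0#))
    ... | yes iso = yes λ x y (c , x≈) (c′ , y≈) → trans (cong x≈ y≈) (iso c c′)
    ... | no ¬iso = no λ iso → ¬iso λ c c′ → iso _ _ (c , ≈V-refl) (c′ , ≈V-refl)

  TotallyIsotropic-Span? : ∀ 𝒫 {k} (g : Vector V k) → Dec (TotallyIsotropic 𝒫 (Span g))
  TotallyIsotropic-Span? (symplectic _ f-sesq _ _)    g = Span-isotropic? f-sesq g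
  TotallyIsotropic-Span? (hermitian _ _ _ f-sesq _ _) g = Span-isotropic? f-sesq g
  TotallyIsotropic-Span? (quadric q q-form _) {k} g
    with all-vectors? k (λ c → q (lincomb c g) ≈ 0#)
                        (λ p q≈0 → trans (IsQuadraticForm.cong q-form (lincomb-cong (sym ∘ p) (λ _ → ≈V-refl))) q≈0)
                        (λ c → q (lincomb c g) ≟F 0#)
  ... | yes iso = yes λ x (c , x≈) → trans (IsQuadraticForm.cong q-form x≈) (iso c)
  ... | no ¬iso = no λ iso → ¬iso λ c → iso _ (c , ≈V-refl)

  module _ (𝒫 : PolarSpace) where

    MaximalIsotropic : ∀ {k} → Vector V k → Set
    MaximalIsotropic g = ∀ x → ¬ Span g x → ¬ TotallyIsotropic 𝒫 (Span (x ∷ g))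

    private
      add-isotropic : ∀ {k} (g : Vector V k) → TotallyIsotropic 𝒫 (Span g) →
                      (Σ V λ x → ¬ Span g x × TotallyIsotropic 𝒫 (Span (x ∷ g))) ⊎ MaximalIsotropic g
      add-isotropic g _ with any-vector? n (λ x → ¬ Span g x × TotallyIsotropic 𝒫 (Span (x ∷ g)))
                               (λ {x} {x′} p (x∉ , iso) → x∉ ∘ IsSubspace.resp (Span-isSubspace g) (≈V-sym p) ,
                                   TotallyIsotropic-⊆ 𝒫 (Span-resp {g = x ∷ g} {x′ ∷ g} λ { zero → p ; (suc i) → ≈V-refl }) iso)
                               (λ x → ¬? (Span? g x) ×-dec TotallyIsotropic-Span? 𝒫 (x ∷ g))
      ... | yes (x , x∉ , iso) = inj₁ (x , x∉ , iso)
      ... | no ∄x = inj₂ λ x x∉ iso → ∄x (x , x∉ , iso)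

      module Isotropic = Greedy (λ g → TotallyIsotropic 𝒫 (Span g)) MaximalIsotropic
                                (λ p → TotallyIsotropic-⊆ 𝒫 (Span-resp p)) add-isotropic

    maximal⇒Generator : ∀ {k} (g : Vector V k) → TotallyIsotropic 𝒫 (Span g) → MaximalIsotropic g →
                        Generator 𝒫 (Span g)
    maximal⇒Generator g iso maximal = record
      { ti      = record { subspace = Span-isSubspace g ; isotropic = iso }
      ; maximal = λ T T-ti g⊆T x x∈T → decidable-stable (Span? g x) λ x∉ →
          maximal x x∉ (TotallyIsotropic-⊆ 𝒫
            (Span-least (IsTISubspace.subspace T-ti) (x ∷ g) λ { zero → x∈T ; (suc i) → g⊆T (g i) (∈-Span g i) })
            (IsTISubspace.isotropic T-ti)) }

    -- A maximal totally isotropic extension of h spans a generator.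
    isotropic-≤-rank : ∀ {d k} → HasRank 𝒫 d → (h : Vector V k) → LinIndep h → TotallyIsotropic 𝒫 (Span h) → k ℕ.≤ d
    isotropic-≤-rank {k = k} rank h h-ind iso with Isotropic.extend h iso h-ind
    ... | m , e , iso′ , ind , maximal =
      ℕ.≤-trans (ℕ.m≤n+m k m)
                (independent-≤-dim (rank _ (maximal⇒Generator (e ++ h) iso′ maximal)) (e ++ h) ind (∈-Span (e ++ h)))

  ⟨,⟩-least : ∀ {A B S} → IsSubspace S → A ⊆ S → B ⊆ S → ⟨_,_⟩ A B ⊆ S
  ⟨,⟩-least S-sub A⊆S B⊆S x (u , v , u∈ , v∈ , x≈) =
    IsSubspace.resp S-sub (≈V-sym x≈) (IsSubspace.+-closed S-sub (A⊆S u u∈) (B⊆S v v∈))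

  ⟨,,⟩-least : ∀ {A B C S} → IsSubspace S → A ⊆ S → B ⊆ S → C ⊆ S → ⟨_,_,_⟩ A B C ⊆ S
  ⟨,,⟩-least S-sub A⊆S B⊆S C⊆S x (u , v , w , u∈ , v∈ , w∈ , x≈) =
    ⟨,⟩-least S-sub (⟨,⟩-least S-sub A⊆S B⊆S) C⊆S x (u +V v , w , (u , v , u∈ , v∈ , ≈V-refl) , w∈ , x≈)

  ⟨,,⟩-isSubspace : ∀ {A B C} → IsSubspace A → IsSubspace B → IsSubspace C → IsSubspace (⟨_,_,_⟩ A B C)
  ⟨,,⟩-isSubspace sA sB sC = record
    { resp     = λ { p (u , v , w , u∈ , v∈ , w∈ , q) → u , v , w , u∈ , v∈ , w∈ , ≈V-trans (≈V-sym p) q }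
    ; zero∈    = 0V , 0V , 0V , zero∈ sA , zero∈ sB , zero∈ sC , ≈V-sym (≈V-trans (+V-identityʳ _) (+V-identityʳ _))
    ; +-closed = λ { (u , v , w , u∈ , v∈ , w∈ , q) (u′ , v′ , w′ , u′∈ , v′∈ , w′∈ , q′) →
        u +V u′ , v +V v′ , w +V w′ , +-closed sA u∈ u′∈ , +-closed sB v∈ v′∈ , +-closed sC w∈ w′∈ ,
        ≈V-trans (+V-cong q q′) (≈V-trans (+V-interchange _ _ _ _) (+V-cong (+V-interchange _ _ _ _) ≈V-refl)) }
    ; •-closed = λ a → λ { (u , v , w , u∈ , v∈ , w∈ , q) →
        a • u , a • v , a • w , •-closed sA a u∈ , •-closed sB a v∈ , •-closed sC a w∈ ,
        ≈V-trans (•-cong refl q) (≈V-trans (•-distribˡ a _ _) (+V-cong (•-distribˡ a u v) ≈V-refl)) } }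
    where open IsSubspace

  module _ {A B C} (sA : IsSubspace A) (sB : IsSubspace B) (sC : IsSubspace C) where
    open IsSubspace

    ⊆-⟨,,⟩₁ : A ⊆ ⟨_,_,_⟩ A B C
    ⊆-⟨,,⟩₁ x x∈ = x , 0V , 0V , x∈ , zero∈ sB , zero∈ sC , ≈V-sym (≈V-trans (+V-identityʳ _) (+V-identityʳ _))

    ⊆-⟨,,⟩₂ : B ⊆ ⟨_,_,_⟩ A B C
    ⊆-⟨,,⟩₂ x x∈ = 0V , x , 0V , zero∈ sA , x∈ , zero∈ sC , ≈V-sym (≈V-trans (+V-identityʳ _) (+V-identityˡ _))

    ⊆-⟨,,⟩₃ : C ⊆ ⟨_,_,_⟩ A B C
    ⊆-⟨,,⟩₃ x x∈ = 0V , 0V , x , zero∈ sA , zero∈ sB , x∈ ,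
                   ≈V-sym (≈V-trans (+V-cong (+V-identityˡ _) ≈V-refl) (+V-identityˡ _))

  ≐-sym : ∀ {A B} → A ≐ B → B ≐ A
  ≐-sym (A⊆B , B⊆A) = B⊆A , A⊆B

  ≐-trans : ∀ {A B C} → A ≐ B → B ≐ C → A ≐ C
  ≐-trans (A⊆B , B⊆A) (B⊆C , C⊆B) = (λ x → B⊆C x ∘ A⊆B x) , (λ x → B⊆A x ∘ C⊆B x)

  ∩-congʳ : ∀ {a B C} → B ≐ C → (a ∩ B) ≐ (a ∩ C)
  ∩-congʳ (B⊆C , C⊆B) = (λ x → map₂ (B⊆C x)) , (λ x → map₂ (C⊆B x))

  ⟨,,⟩-swap : ∀ {A B C} → ⟨_,_,_⟩ A B C ≐ ⟨_,_,_⟩ A C B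
  ⟨,,⟩-swap = exchange , exchange
    where
    exchange : ∀ {A B C} → ⟨_,_,_⟩ A B C ⊆ ⟨_,_,_⟩ A C B
    exchange x (u , v , w , u∈ , v∈ , w∈ , x≈) = u , w , v , u∈ , w∈ , v∈ , ≈V-trans x≈ (+V-swapʳ u v w)

  ⟨,,⟩-rotate : ∀ {A B C} → ⟨_,_,_⟩ A B C ≐ ⟨_,_,_⟩ B C A
  ⟨,,⟩-rotate = rotate , (λ x → rotate x ∘ rotate x)
    where
    rotate : ∀ {A B C} → ⟨_,_,_⟩ A B C ⊆ ⟨_,_,_⟩ B C A
    rotate x (u , v , w , u∈ , v∈ , w∈ , x≈) = v , w , u , v∈ , w∈ , u∈ ,
      ≈V-trans x≈ (≈V-trans (+V-cong (+V-comm u v) ≈V-refl)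
                  (≈V-trans (+V-assoc v u w) (≈V-trans (+V-cong ≈V-refl (+V-comm u w)) (≈V-sym (+V-assoc v w u)))))

  ∩-absorbs-⟨,,⟩ : ∀ {a A B C} → IsSubspace a → IsSubspace A → IsSubspace C →
                   A ⊆ a → B ⊆ a → (a ∩ C) ⊆ A → (a ∩ ⟨_,_,_⟩ A B C) ≐ ⟨_,_⟩ A B
  ∩-absorbs-⟨,,⟩ {a} {A} {B} {C} sa sA sC A⊆a B⊆a a∩C⊆A = to , from
    where
    open IsSubspace
    to : (a ∩ ⟨_,_,_⟩ A B C) ⊆ ⟨_,_⟩ A B
    to x (x∈a , u , v , w , u∈ , v∈ , w∈ , x≈) =
      u +V w , v , +-closed sA u∈ (a∩C⊆A w (w∈a , w∈)) , v∈ , ≈V-trans x≈ (+V-swapʳ u v w)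
      where
      w∈a : a w
      w∈a = ∈-difference sa x≈ x∈a (+-closed sa (A⊆a u u∈) (B⊆a v v∈))
    from : ⟨_,_⟩ A B ⊆ (a ∩ ⟨_,_,_⟩ A B C)
    from x (u , v , u∈ , v∈ , x≈) =
      ⟨,⟩-least sa A⊆a B⊆a x (u , v , u∈ , v∈ , x≈) ,
      (u , v , 0V , u∈ , v∈ , zero∈ sC , ≈V-trans x≈ (≈V-sym (+V-identityʳ _)))

  HasDim-resp-≐ : ∀ {A B k} → A ≐ B → HasDim A k → HasDim B k
  HasDim-resp-≐ (A⊆B , B⊆A) (b , b∈ , b-ind , b-spans) = b , (λ i → A⊆B _ (b∈ i)) , b-ind , (λ x → b-spans x ∘ B⊆A x)

  Span-++-least : ∀ {m k l} (e : Vector V m) (g : Vector V k) (h : Vector V l) →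
                  (∀ i → Span h (e i)) → (∀ i → Span h (g i)) → Span (e ++ g) ⊆ Span h
  Span-++-least e g h e∈ g∈ = Span-mono (e ++ g) h (++-all (Span h) e g e∈ g∈)

  Span-⊆-++ʳ : ∀ {m k} (e : Vector V m) (g : Vector V k) → Span g ⊆ Span (e ++ g)
  Span-⊆-++ʳ e g = Span-mono g (e ++ g) (∈-Span-++ʳ e g)

  module _ {p} {z : Vector V p} where

    basis-∈ˡ : ∀ {m} {S : Subspace} (e : Vector V m) → IsBasis S (e ++ z) → ∀ i → S (e i)
    basis-∈ˡ {S = S} e (ez∈ , _) i = ≡.subst S (lookup-++ˡ e z i) (ez∈ _)

    private
      basis-⊆-Span : ∀ {m l} {S : Subspace} (e : Vector V m) (h : Vector V l) → IsBasis S (e ++ z) →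
                     (∀ i → Span h (e i)) → (∀ i → Span h (z i)) → S ⊆ Span h
      basis-⊆-Span e h (_ , _ , S-spanned) e∈h z∈h x = Span-++-least e z h e∈h z∈h x ∘ S-spanned x

    ⟨,⟩-basis : ∀ {A B m₁ m₂} {e₁ : Vector V m₁} {e₂ : Vector V m₂} → IsSubspace A → IsSubspace B →
                IsBasis A (e₁ ++ z) → IsBasis B (e₂ ++ z) → LinIndep (e₂ ++ (e₁ ++ z)) →
                IsBasis (⟨_,_⟩ A B) (e₂ ++ (e₁ ++ z))
    ⟨,⟩-basis {A} {B} {m₁} {m₂} {e₁} {e₂} sA sB A-basis B-basis ind =
        ++-all (⟨_,_⟩ A B) e₂ (e₁ ++ z) (λ i → inB _ (basis-∈ˡ e₂ B-basis i)) (λ i → inA _ (proj₁ A-basis i))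
      , ind
      , ⟨,⟩-least (Span-isSubspace h)
          (λ x → Span-⊆-++ʳ e₂ (e₁ ++ z) x ∘ proj₂ (proj₂ A-basis) x)
          (basis-⊆-Span e₂ h B-basis (∈-Span-++ˡ e₂ (e₁ ++ z)) (λ i → Span-⊆-++ʳ e₂ (e₁ ++ z) _ (∈-Span-++ʳ e₁ z i)))
      where
      h : Vector V (m₂ ℕ.+ (m₁ ℕ.+ p))
      h = e₂ ++ (e₁ ++ z)
      inA : A ⊆ ⟨_,_⟩ A B
      inA x x∈ = x , 0V , x∈ , IsSubspace.zero∈ sB , ≈V-sym (+V-identityʳ x)
      inB : B ⊆ ⟨_,_⟩ A B
      inB x x∈ = 0V , x , IsSubspace.zero∈ sA , x∈ , ≈V-sym (+V-identityˡ x)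

    ⟨,,⟩-basis : ∀ {A B C m₁ m₂ m₃} {e₁ : Vector V m₁} {e₂ : Vector V m₂} {e₃ : Vector V m₃} →
                 IsSubspace A → IsSubspace B → IsSubspace C →
                 IsBasis A (e₁ ++ z) → IsBasis B (e₂ ++ z) → IsBasis C (e₃ ++ z) →
                 LinIndep (e₃ ++ (e₂ ++ (e₁ ++ z))) → IsBasis (⟨_,_,_⟩ A B C) (e₃ ++ (e₂ ++ (e₁ ++ z)))
    ⟨,,⟩-basis {A} {B} {C} {m₁} {m₂} {m₃} {e₁} {e₂} {e₃} sA sB sC A-basis B-basis C-basis ind =
        ++-all (⟨_,_,_⟩ A B C) e₃ _ (λ i → ⊆-⟨,,⟩₃ sA sB sC _ (basis-∈ˡ e₃ C-basis i))
          (++-all (⟨_,_,_⟩ A B C) e₂ _ (λ i → ⊆-⟨,,⟩₂ sA sB sC _ (basis-∈ˡ e₂ B-basis i))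
                                       (λ i → ⊆-⟨,,⟩₁ sA sB sC _ (proj₁ A-basis i)))
      , ind
      , ⟨,,⟩-least (Span-isSubspace h)
          (λ x → inner x ∘ proj₂ (proj₂ A-basis) x)
          (basis-⊆-Span e₂ h B-basis (λ i → Span-⊆-++ʳ e₃ _ _ (∈-Span-++ˡ e₂ (e₁ ++ z) i)) z∈h)
          (basis-⊆-Span e₃ h C-basis (∈-Span-++ˡ e₃ _) z∈h)
      where
      h : Vector V (m₃ ℕ.+ (m₂ ℕ.+ (m₁ ℕ.+ p)))
      h = e₃ ++ (e₂ ++ (e₁ ++ z))
      inner : Span (e₁ ++ z) ⊆ Span h
      inner x = Span-⊆-++ʳ e₃ _ x ∘ Span-⊆-++ʳ e₂ (e₁ ++ z) x
      z∈h : ∀ i → Span h (z i)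
      z∈h i = inner _ (∈-Span-++ʳ e₁ z i)

  module _ {σ} {f : V → V → Carrier} (f-sesq : IsSesquilinear σ f) (σ1≈1 : σ 1# ≈ 1#) where
    open IsSesquilinear f-sesq

    f-+ˡ : ∀ x y z → f (x +V y) z ≈ f x z + f y z
    f-+ˡ x y z = trans (cong (+V-cong (≈V-sym (•-identityˡ x)) ≈V-refl) ≈V-refl)
                       (trans (linˡ 1# x y z) (+-cong (*-identityˡ _) refl))

    f-+ʳ : ∀ x y z → f x (y +V z) ≈ f x y + f x z
    f-+ʳ x y z = trans (cong ≈V-refl (+V-cong (≈V-sym (•-identityˡ y)) ≈V-refl))
                       (trans (linʳ 1# x y z) (+-cong (trans (*-cong σ1≈1 refl) (*-identityˡ _)) refl))

    Orthogonal : Subspace → Subspace → Set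
    Orthogonal A B = ∀ x y → A x → B y → f x y ≈ 0#

    private
      0+0+0≈0 : ∀ {a b c} → a ≈ 0# → b ≈ 0# → c ≈ 0# → (a + b) + c ≈ 0#
      0+0+0≈0 a≈0 b≈0 c≈0 = trans (+-cong (trans (+-cong a≈0 b≈0) (+-identityʳ 0#)) c≈0) (+-identityʳ 0#)

    ⟨,,⟩-orthogonalˡ : ∀ {A B C S} → Orthogonal A S → Orthogonal B S → Orthogonal C S → Orthogonal (⟨_,_,_⟩ A B C) S
    ⟨,,⟩-orthogonalˡ A⊥S B⊥S C⊥S x y (u , v , w , u∈ , v∈ , w∈ , x≈) y∈ =
      trans (cong x≈ ≈V-refl) (trans (f-+ˡ _ _ _) (trans (+-cong (f-+ˡ _ _ _) refl)
            (0+0+0≈0 (A⊥S u y u∈ y∈) (B⊥S v y v∈ y∈) (C⊥S w y w∈ y∈))))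

    ⟨,,⟩-orthogonalʳ : ∀ {A B C S} → Orthogonal S A → Orthogonal S B → Orthogonal S C → Orthogonal S (⟨_,_,_⟩ A B C)
    ⟨,,⟩-orthogonalʳ S⊥A S⊥B S⊥C x y x∈ (u , v , w , u∈ , v∈ , w∈ , y≈) =
      trans (cong ≈V-refl y≈) (trans (f-+ʳ _ _ _) (trans (+-cong (f-+ʳ _ _ _) refl)
            (0+0+0≈0 (S⊥A x u x∈ u∈) (S⊥B x v x∈ v∈) (S⊥C x w x∈ w∈))))

    ⟨∩,∩,∩⟩-orthogonal : ∀ {a₁ a₂ a₃} → Orthogonal a₁ a₁ → Orthogonal a₂ a₂ → Orthogonal a₃ a₃ →
                         Orthogonal (⟨_,_,_⟩ (a₁ ∩ a₂) (a₁ ∩ a₃) (a₂ ∩ a₃)) (⟨_,_,_⟩ (a₁ ∩ a₂) (a₁ ∩ a₃) (a₂ ∩ a₃))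
    ⟨∩,∩,∩⟩-orthogonal iso₁ iso₂ iso₃ =
      ⟨,,⟩-orthogonalˡ (⟨,,⟩-orthogonalʳ (inside iso₁ proj₁ proj₁) (inside iso₁ proj₁ proj₁) (inside iso₂ proj₂ proj₁))
                       (⟨,,⟩-orthogonalʳ (inside iso₁ proj₁ proj₁) (inside iso₁ proj₁ proj₁) (inside iso₃ proj₂ proj₂))
                       (⟨,,⟩-orthogonalʳ (inside iso₂ proj₁ proj₂) (inside iso₃ proj₂ proj₂) (inside iso₂ proj₁ proj₁))
      where
      inside : ∀ {a A B : Subspace} → Orthogonal a a → (∀ {x} → A x → a x) → (∀ {x} → B x → a x) → Orthogonal A B
      inside iso A⊆a B⊆a x y x∈ y∈ = iso x y (A⊆a x∈) (B⊆a y∈)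

  module _ {q : V → Carrier} (q-form : IsQuadraticForm q) where
    open IsQuadraticForm q-form

    q-+ : ∀ {x y} → q x ≈ 0# → q y ≈ 0# → polar q x y ≈ 0# → q (x +V y) ≈ 0#
    q-+ {x} {y} qx≈0 qy≈0 polar≈0 = begin
      q (x +V y)                 ≈⟨ +-identityʳ _ ⟨
      q (x +V y) + 0#            ≈⟨ +-cong (+-identityʳ _) (-0#≈0#) ⟨
      (q (x +V y) + 0#) - 0#     ≈⟨ +-cong (+-cong refl (trans (-‿cong qx≈0) -0#≈0#)) (-‿cong qy≈0) ⟨
      (q (x +V y) - q x) - q y   ≈⟨ polar≈0 ⟩
      0#                         ∎
      where open SetoidReasoning setoid

    polar-vanishes : ∀ {a} → IsSubspace a → (∀ x → a x → q x ≈ 0#) → ∀ x y → a x → a y → polar q x y ≈ 0#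
    polar-vanishes sa singular x y x∈ y∈ =
      trans (+-cong (+-cong (singular _ (IsSubspace.+-closed sa x∈ y∈)) (-‿cong (singular x x∈))) (-‿cong (singular y y∈)))
            (trans (+-cong (+-cong refl -0#≈0#) -0#≈0#) (trans (+-identityʳ _) (+-identityʳ _)))

    ⟨∩,∩,∩⟩-singular : ∀ {a₁ a₂ a₃} → IsSubspace a₁ → IsSubspace a₂ → IsSubspace a₃ →
                       (∀ x → a₁ x → q x ≈ 0#) → (∀ x → a₂ x → q x ≈ 0#) → (∀ x → a₃ x → q x ≈ 0#) →
                       ∀ x → ⟨_,_,_⟩ (a₁ ∩ a₂) (a₁ ∩ a₃) (a₂ ∩ a₃) x → q x ≈ 0#
    ⟨∩,∩,∩⟩-singular s₁ s₂ s₃ sing₁ sing₂ sing₃ x (u , v , w , (u₁ , u₂) , (v₁ , v₃) , (w₂ , w₃) , x≈) =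
      trans (cong x≈)
            (q-+ (q-+ (sing₁ u u₁) (sing₁ v v₁) (polar-vanishes s₁ sing₁ u v u₁ v₁)) (sing₂ w w₂)
                 (trans (f-+ˡ polar-bilinear refl u v w)
                        (trans (+-cong (polar-vanishes s₂ sing₂ u w u₂ w₂) (polar-vanishes s₃ sing₃ v w v₃ w₃))
                               (+-identityʳ 0#))))

  ⟨∩,∩,∩⟩-isotropic : ∀ 𝒫 {a₁ a₂ a₃} → IsTISubspace 𝒫 a₁ → IsTISubspace 𝒫 a₂ → IsTISubspace 𝒫 a₃ →
                      TotallyIsotropic 𝒫 (⟨_,_,_⟩ (a₁ ∩ a₂) (a₁ ∩ a₃) (a₂ ∩ a₃))
  ⟨∩,∩,∩⟩-isotropic (symplectic _ f-sesq _ _) t₁ t₂ t₃ =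
    ⟨∩,∩,∩⟩-orthogonal f-sesq refl (isotropic t₁) (isotropic t₂) (isotropic t₃)
    where open IsTISubspace
  ⟨∩,∩,∩⟩-isotropic (hermitian _ σ-inv _ f-sesq _ _) t₁ t₂ t₃ =
    ⟨∩,∩,∩⟩-orthogonal f-sesq (IsInvolution.hom1 σ-inv) (isotropic t₁) (isotropic t₂) (isotropic t₃)
    where open IsTISubspace
  ⟨∩,∩,∩⟩-isotropic (quadric _ q-form _) t₁ t₂ t₃ =
    ⟨∩,∩,∩⟩-singular q-form (subspace t₁) (subspace t₂) (subspace t₃) (isotropic t₁) (isotropic t₂) (isotropic t₃)
    where open IsTISubspace

  extension-independent : ∀ {R A B p m k} {z : Vector V p} {e : Vector V m} {g : Vector V k} →
                          IsBasis R z → IsSubspace A → IsSubspace B → IsBasis B (e ++ z) →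
                          (∀ i → A (g i)) → LinIndep g → (A ∩ B) ⊆ R → LinIndep (e ++ g)
  extension-independent {z = z} {e} {g} (_ , _ , R-spanned) sA sB B-basis g∈A g-ind A∩B⊆R =
    ++-independent e g z g-ind (proj₁ (proj₂ B-basis)) λ w w∈e w∈g →
      R-spanned w (A∩B⊆R w (Span-least sA g g∈A w w∈g , Span-least sB e (basis-∈ˡ e B-basis) w w∈e))

  -- The incidences of the pairwise intersections Lᵢⱼ = aᵢ ∩ aⱼ of three
  -- subspaces, with R = a₁ ∩ a₂ ∩ a₃ and A₁ = a₁.
  record Configuration (R L₁₂ L₁₃ L₂₃ A₁ : Subspace) : Set where
    field
      R-sub   : IsSubspace R
      L₁₂-sub : IsSubspace L₁₂
      L₁₃-sub : IsSubspace L₁₃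
      L₂₃-sub : IsSubspace L₂₃
      A₁-sub  : IsSubspace A₁
      R?   : U.Decidable R
      L₁₂? : U.Decidable L₁₂
      L₁₃? : U.Decidable L₁₃
      L₂₃? : U.Decidable L₂₃
      R⊆L₁₂ : R ⊆ L₁₂
      R⊆L₁₃ : R ⊆ L₁₃
      R⊆L₂₃ : R ⊆ L₂₃
      L₁₂⊆A₁ : L₁₂ ⊆ A₁
      L₁₃⊆A₁ : L₁₃ ⊆ A₁
      L₁₂∩L₁₃⊆R : (L₁₂ ∩ L₁₃) ⊆ R
      A₁∩L₂₃⊆R : (A₁ ∩ L₂₃) ⊆ R

  ∩-configuration : ∀ {b R L₁₂ L₁₃ L₂₃ A₁} → IsSubspace b → U.Decidable b → Configuration R L₁₂ L₁₃ L₂₃ A₁ →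
                    Configuration (b ∩ R) (b ∩ L₁₂) (b ∩ L₁₃) (b ∩ L₂₃) A₁
  ∩-configuration sb b? C = record
    { R-sub = ∩-isSubspace sb R-sub ; L₁₂-sub = ∩-isSubspace sb L₁₂-sub
    ; L₁₃-sub = ∩-isSubspace sb L₁₃-sub ; L₂₃-sub = ∩-isSubspace sb L₂₃-sub ; A₁-sub = A₁-sub
    ; R? = b? ∩? R? ; L₁₂? = b? ∩? L₁₂? ; L₁₃? = b? ∩? L₁₃? ; L₂₃? = b? ∩? L₂₃?
    ; R⊆L₁₂ = λ x → map₂ (R⊆L₁₂ x) ; R⊆L₁₃ = λ x → map₂ (R⊆L₁₃ x) ; R⊆L₂₃ = λ x → map₂ (R⊆L₂₃ x)
    ; L₁₂⊆A₁ = λ x → L₁₂⊆A₁ x ∘ proj₂ ; L₁₃⊆A₁ = λ x → L₁₃⊆A₁ x ∘ proj₂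
    ; L₁₂∩L₁₃⊆R = λ { x ((x∈b , x∈L₁₂) , (_ , x∈L₁₃)) → x∈b , L₁₂∩L₁₃⊆R x (x∈L₁₂ , x∈L₁₃) }
    ; A₁∩L₂₃⊆R = λ { x (x∈A₁ , x∈b , x∈L₂₃) → x∈b , A₁∩L₂₃⊆R x (x∈A₁ , x∈L₂₃) } }
    where open Configuration C

  record AdaptedBases (R L₁₂ L₁₃ L₂₃ : Subspace) : Set where
    field
      p m₁₂ m₁₃ m₂₃ : ℕ
      z   : Vector V p
      e₁₂ : Vector V m₁₂
      e₁₃ : Vector V m₁₃
      e₂₃ : Vector V m₂₃
      R-basis   : IsBasis R z
      L₁₂-basis : IsBasis L₁₂ (e₁₂ ++ z)
      L₁₃-basis : IsBasis L₁₃ (e₁₃ ++ z)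
      L₂₃-basis : IsBasis L₂₃ (e₂₃ ++ z)

  module _ {R L₁₂ L₁₃ L₂₃ A₁} (C : Configuration R L₁₂ L₁₃ L₂₃ A₁) where
    open Configuration C

    abstract
      adapted-bases : AdaptedBases R L₁₂ L₁₃ L₂₃
      adapted-bases with ∃-dim R-sub R?
      ... | p , z , R-basis@(z∈R , z-ind , _)
          with extend-to-basis L₁₂-sub L₁₂? z (λ i → R⊆L₁₂ _ (z∈R i)) z-ind
             | extend-to-basis L₁₃-sub L₁₃? z (λ i → R⊆L₁₃ _ (z∈R i)) z-ind
             | extend-to-basis L₂₃-sub L₂₃? z (λ i → R⊆L₂₃ _ (z∈R i)) z-ind
      ... | m₁₂ , e₁₂ , L₁₂-basis | m₁₃ , e₁₃ , L₁₃-basis | m₂₃ , e₂₃ , L₂₃-basis = record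
        { p = p ; m₁₂ = m₁₂ ; m₁₃ = m₁₃ ; m₂₃ = m₂₃ ; z = z ; e₁₂ = e₁₂ ; e₁₃ = e₁₃ ; e₂₃ = e₂₃
        ; R-basis = R-basis ; L₁₂-basis = L₁₂-basis ; L₁₃-basis = L₁₃-basis ; L₂₃-basis = L₂₃-basis }

    module _ (B : AdaptedBases R L₁₂ L₁₃ L₂₃) where
      open AdaptedBases B

      private
        e₁₂z∈A₁ : ∀ i → A₁ ((e₁₂ ++ z) i)
        e₁₂z∈A₁ i = L₁₂⊆A₁ _ (proj₁ L₁₂-basis i)

      independent₁₂₁₃ : LinIndep (e₁₃ ++ (e₁₂ ++ z))
      independent₁₂₁₃ = extension-independent R-basis L₁₂-sub L₁₃-sub L₁₃-basis
                          (proj₁ L₁₂-basis) (proj₁ (proj₂ L₁₂-basis)) L₁₂∩L₁₃⊆R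

      independent₁₂₂₃ : LinIndep (e₂₃ ++ (e₁₂ ++ z))
      independent₁₂₂₃ = extension-independent R-basis A₁-sub L₂₃-sub L₂₃-basis
                          e₁₂z∈A₁ (proj₁ (proj₂ L₁₂-basis)) A₁∩L₂₃⊆R

      independent₁₃₂₃ : LinIndep (e₂₃ ++ (e₁₃ ++ z))
      independent₁₃₂₃ = extension-independent R-basis A₁-sub L₂₃-sub L₂₃-basis
                          (λ i → L₁₃⊆A₁ _ (proj₁ L₁₃-basis i)) (proj₁ (proj₂ L₁₃-basis)) A₁∩L₂₃⊆R

      ⟨,,⟩-adapted-basis : IsBasis (⟨_,_,_⟩ L₁₂ L₁₃ L₂₃) (e₂₃ ++ (e₁₃ ++ (e₁₂ ++ z)))
      ⟨,,⟩-adapted-basis = ⟨,,⟩-basis {z = z} {e₁ = e₁₂} {e₂ = e₁₃} {e₃ = e₂₃} L₁₂-sub L₁₃-sub L₂₃-sub L₁₂-basis L₁₃-basis L₂₃-basis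
        (extension-independent R-basis A₁-sub L₂₃-sub L₂₃-basis
          (++-all A₁ e₁₃ (e₁₂ ++ z) (λ i → L₁₃⊆A₁ _ (basis-∈ˡ e₁₃ L₁₃-basis i)) e₁₂z∈A₁)
          independent₁₂₁₃ A₁∩L₂₃⊆R)

module EKRTriangles (F : FiniteField) (n : ℕ) where
  open import Function using (_∘_)
  open import Data.Nat using (_+_; _*_; _∸_; _≤_)
  open import Data.Nat.Properties
    using (≤-trans; ≤-reflexive; +-comm; +-monoˡ-≤; m≤n+o⇒m∸n≤o; m≤o∸n⇒m+n≤o; _≤?_; ≰⇒>)
  open import Data.Product using (_×_; _,_; proj₁; proj₂; map₂)
  open import Data.Sum using (_⊎_; inj₁; inj₂)
  open import Data.Vec.Functional using (_++_)
  open import Relation.Nullary using (yes; no)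
  import Relation.Unary as U
  open import Relation.Unary.Properties using (_∩?_)
  open import Relation.Binary.PropositionalEquality as ≡ using (_≡_)
  open Over F n
  open LinearAlgebra F n

  module _ (𝒫 : PolarSpace) {d h : ℕ} (rank : HasRank 𝒫 d) {Y : Subspace → Set} (ekr : IsEKR 𝒫 d (h * 2) Y) where
    open Arithmetic {d} {h}

    private
      isTI : ∀ {a} → Y a → IsTISubspace 𝒫 a
      isTI y = Generator.ti (proj₁ ekr _ y)

      sub : ∀ {a} → Y a → IsSubspace a
      sub y = IsTISubspace.subspace (isTI y)

      dec : ∀ {a} → Y a → U.Decidable a
      dec y = HasDim⇒Decidable (sub y) (rank _ (proj₁ ekr _ y))

    ekr-bound : ∀ {a a′ k} → Y a → Y a′ → HasDim (a ∩ a′) k → d ≤ k + h * 2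
    ekr-bound y y′ k-dim with proj₂ ekr _ _ y y′
    ... | k′ , (β , β∈ , β-ind , _) , d≤k′+t = ≤-trans d≤k′+t (+-monoˡ-≤ (h * 2) (independent-≤-dim k-dim β β-ind β∈))

    triangle-configuration : ∀ {a₁ a₂ a₃} → Y a₁ → Y a₂ → Y a₃ →
                             Configuration ((a₁ ∩ a₂) ∩ a₃) (a₁ ∩ a₂) (a₁ ∩ a₃) (a₂ ∩ a₃) a₁
    triangle-configuration y₁ y₂ y₃ = record
      { R-sub = ∩-isSubspace (∩-isSubspace (sub y₁) (sub y₂)) (sub y₃)
      ; L₁₂-sub = ∩-isSubspace (sub y₁) (sub y₂) ; L₁₃-sub = ∩-isSubspace (sub y₁) (sub y₃)
      ; L₂₃-sub = ∩-isSubspace (sub y₂) (sub y₃) ; A₁-sub = sub y₁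
      ; R? = (dec y₁ ∩? dec y₂) ∩? dec y₃
      ; L₁₂? = dec y₁ ∩? dec y₂ ; L₁₃? = dec y₁ ∩? dec y₃ ; L₂₃? = dec y₂ ∩? dec y₃
      ; R⊆L₁₂ = λ x → proj₁
      ; R⊆L₁₃ = λ { x ((x₁ , _) , x₃) → x₁ , x₃ }
      ; R⊆L₂₃ = λ { x ((_ , x₂) , x₃) → x₂ , x₃ }
      ; L₁₂⊆A₁ = λ x → proj₁ ; L₁₃⊆A₁ = λ x → proj₁
      ; L₁₂∩L₁₃⊆R = λ { x ((x₁ , x₂) , (_ , x₃)) → (x₁ , x₂) , x₃ }
      ; A₁∩L₂₃⊆R = λ { x (x₁ , x₂ , x₃) → (x₁ , x₂) , x₃ } }

    module Triangle {a₁ a₂ a₃} (y₁ : Y a₁) (y₂ : Y a₂) (y₃ : Y a₃) where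
      configuration : Configuration ((a₁ ∩ a₂) ∩ a₃) (a₁ ∩ a₂) (a₁ ∩ a₃) (a₂ ∩ a₃) a₁
      configuration = triangle-configuration y₁ y₂ y₃

      bases : AdaptedBases ((a₁ ∩ a₂) ∩ a₃) (a₁ ∩ a₂) (a₁ ∩ a₃) (a₂ ∩ a₃)
      bases = adapted-bases configuration

      open Configuration configuration using (L₁₂-sub; L₁₃-sub; L₂₃-sub)
      open AdaptedBases bases public

      U-basis : IsBasis (⟨_,_,_⟩ (a₁ ∩ a₂) (a₁ ∩ a₃) (a₂ ∩ a₃)) (e₂₃ ++ (e₁₃ ++ (e₁₂ ++ z)))
      U-basis = ⟨,,⟩-adapted-basis configuration bases

      U-bound : m₂₃ + (m₁₃ + (m₁₂ + p)) ≤ d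
      U-bound = isotropic-≤-rank 𝒫 rank _ (proj₁ (proj₂ U-basis))
                  (TotallyIsotropic-⊆ 𝒫 (Span-least (⟨,,⟩-isSubspace L₁₂-sub L₁₃-sub L₂₃-sub) _ (proj₁ U-basis))
                                        (⟨∩,∩,∩⟩-isotropic 𝒫 (isTI y₁) (isTI y₂) (isTI y₃)))

      ℓ₁₂-bound : d ≤ m₁₂ + p + h * 2
      ℓ₁₂-bound = ekr-bound y₁ y₂ (_ , L₁₂-basis)

      ℓ₁₃-bound : d ≤ m₁₃ + p + h * 2
      ℓ₁₃-bound = ekr-bound y₁ y₃ (_ , L₁₃-basis)

      ℓ₂₃-bound : d ≤ m₂₃ + p + h * 2
      ℓ₂₃-bound = ekr-bound y₂ y₃ (_ , L₂₃-basis)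

      P-bound : d ≤ p + 3 * h
      P-bound = d≤p+3h {p} ℓ₁₂-bound ℓ₁₃-bound ℓ₂₃-bound U-bound

      P-dim-lower : DimAtLeast ((a₁ ∩ a₂) ∩ a₃) (d ∸ 3 * h)
      P-dim-lower = p , (z , R-basis) , m≤n+o⇒m∸n≤o d (3 * h) (≤-trans P-bound (≤-reflexive (+-comm p (3 * h))))

      a₁∩U≐ : (a₁ ∩ ⟨_,_,_⟩ (a₁ ∩ a₂) (a₁ ∩ a₃) (a₂ ∩ a₃)) ≐ ⟨_,_⟩ (a₁ ∩ a₂) (a₁ ∩ a₃)
      a₁∩U≐ = ∩-absorbs-⟨,,⟩ (sub y₁) L₁₂-sub L₂₃-sub (λ x → proj₁) (λ x → proj₁) (λ { x (x₁ , x₂ , _) → x₁ , x₂ })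

      a₂∩U≐ : (a₂ ∩ ⟨_,_,_⟩ (a₁ ∩ a₂) (a₁ ∩ a₃) (a₂ ∩ a₃)) ≐ ⟨_,_⟩ (a₁ ∩ a₂) (a₂ ∩ a₃)
      a₂∩U≐ = ≐-trans (∩-congʳ ⟨,,⟩-swap)
                      (∩-absorbs-⟨,,⟩ (sub y₂) L₁₂-sub L₁₃-sub (λ x → proj₂) (λ x → proj₁) (λ { x (x₂ , x₁ , _) → x₁ , x₂ }))

      a₃∩U≐ : (a₃ ∩ ⟨_,_,_⟩ (a₁ ∩ a₂) (a₁ ∩ a₃) (a₂ ∩ a₃)) ≐ ⟨_,_⟩ (a₁ ∩ a₃) (a₂ ∩ a₃)
      a₃∩U≐ = ≐-trans (∩-congʳ ⟨,,⟩-rotate)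
                      (∩-absorbs-⟨,,⟩ (sub y₃) L₁₃-sub L₁₂-sub (λ x → proj₂) (λ x → proj₂) (λ { x (x₃ , x₁ , _) → x₁ , x₃ }))

      module Extremal (P-dim : HasDim ((a₁ ∩ a₂) ∩ a₃) (d ∸ 3 * h)) (4h≤d : 2 * (h * 2) ≤ d) where
        private
          p+3h≤d : p + 3 * h ≤ d
          p+3h≤d = m≤o∸n⇒m+n≤o p (≤-trans 3h≤4h 4h≤d) (independent-≤-dim P-dim z (proj₁ (proj₂ R-basis)) (proj₁ R-basis))

          sizes : d ≡ p + 3 * h × m₁₂ ≡ h × m₁₃ ≡ h × m₂₃ ≡ h
          sizes = extremal p+3h≤d ℓ₁₂-bound ℓ₁₃-bound ℓ₂₃-bound U-bound

          d≡p+3h : d ≡ p + 3 * h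
          d≡p+3h = proj₁ sizes

          m₁₂≡h : m₁₂ ≡ h
          m₁₂≡h = proj₁ (proj₂ sizes)

          m₁₃≡h : m₁₃ ≡ h
          m₁₃≡h = proj₁ (proj₂ (proj₂ sizes))

          m₂₃≡h : m₂₃ ≡ h
          m₂₃≡h = proj₂ (proj₂ (proj₂ sizes))

        U-dim : HasDim (⟨_,_,_⟩ (a₁ ∩ a₂) (a₁ ∩ a₃) (a₂ ∩ a₃)) d
        U-dim = ≡.subst (HasDim _) (span-size d≡p+3h m₁₂≡h m₁₃≡h m₂₃≡h) (_ , U-basis)

        ℓ₁₂-dim : HasDim (a₁ ∩ a₂) (d ∸ h * 2)
        ℓ₁₂-dim = ≡.subst (HasDim _) (pair-size d≡p+3h m₁₂≡h) (_ , L₁₂-basis)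

        ℓ₁₃-dim : HasDim (a₁ ∩ a₃) (d ∸ h * 2)
        ℓ₁₃-dim = ≡.subst (HasDim _) (pair-size d≡p+3h m₁₃≡h) (_ , L₁₃-basis)

        ℓ₂₃-dim : HasDim (a₂ ∩ a₃) (d ∸ h * 2)
        ℓ₂₃-dim = ≡.subst (HasDim _) (pair-size d≡p+3h m₂₃≡h) (_ , L₂₃-basis)

        a₁∩U-dim : HasDim (a₁ ∩ ⟨_,_,_⟩ (a₁ ∩ a₂) (a₁ ∩ a₃) (a₂ ∩ a₃)) (d ∸ h)
        a₁∩U-dim = HasDim-resp-≐ (≐-sym a₁∩U≐) (≡.subst (HasDim _) (flag-size d≡p+3h m₁₃≡h m₁₂≡h)
                     (_ , ⟨,⟩-basis {z = z} {e₁ = e₁₂} {e₂ = e₁₃} L₁₂-sub L₁₃-sub L₁₂-basis L₁₃-basis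
                                    (independent₁₂₁₃ configuration bases)))

        a₂∩U-dim : HasDim (a₂ ∩ ⟨_,_,_⟩ (a₁ ∩ a₂) (a₁ ∩ a₃) (a₂ ∩ a₃)) (d ∸ h)
        a₂∩U-dim = HasDim-resp-≐ (≐-sym a₂∩U≐) (≡.subst (HasDim _) (flag-size d≡p+3h m₂₃≡h m₁₂≡h)
                     (_ , ⟨,⟩-basis {z = z} {e₁ = e₁₂} {e₂ = e₂₃} L₁₂-sub L₂₃-sub L₁₂-basis L₂₃-basis
                                    (independent₁₂₂₃ configuration bases)))

        a₃∩U-dim : HasDim (a₃ ∩ ⟨_,_,_⟩ (a₁ ∩ a₂) (a₁ ∩ a₃) (a₂ ∩ a₃)) (d ∸ h)
        a₃∩U-dim = HasDim-resp-≐ (≐-sym a₃∩U≐) (≡.subst (HasDim _) (flag-size d≡p+3h m₂₃≡h m₁₃≡h)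
                     (_ , ⟨,⟩-basis {z = z} {e₁ = e₁₃} {e₂ = e₂₃} L₁₃-sub L₂₃-sub L₁₃-basis L₂₃-basis
                                    (independent₁₃₂₃ configuration bases)))

    triangle-bound : ∀ {a a′ b k} → Y b → Y a → Y a′ → HasDim (b ∩ (a ∩ a′)) k → d ≤ k + 3 * h
    triangle-bound {a} {a′} {b} yb y y′ k-dim =
      ≤-trans P-bound (+-monoˡ-≤ (3 * h) (independent-≤-dim k-dim z (proj₁ (proj₂ R-basis)) (reassoc ∘ proj₁ R-basis)))
      where
      open Triangle yb y y′
      reassoc : ∀ {x} → ((b ∩ a) ∩ a′) x → (b ∩ (a ∩ a′)) x
      reassoc ((x∈b , x∈a) , x∈a′) = x∈b , x∈a , x∈a′

    module Cut {a₁ a₂ a₃ b} (y₁ : Y a₁) (y₂ : Y a₂) (y₃ : Y a₃) (yb : Y b) where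
      private
        triangle : Configuration ((a₁ ∩ a₂) ∩ a₃) (a₁ ∩ a₂) (a₁ ∩ a₃) (a₂ ∩ a₃) a₁
        triangle = triangle-configuration y₁ y₂ y₃

        configuration : Configuration (b ∩ ((a₁ ∩ a₂) ∩ a₃)) (b ∩ (a₁ ∩ a₂)) (b ∩ (a₁ ∩ a₃)) (b ∩ (a₂ ∩ a₃)) a₁
        configuration = ∩-configuration (sub yb) (dec yb) triangle

        bases : AdaptedBases (b ∩ ((a₁ ∩ a₂) ∩ a₃)) (b ∩ (a₁ ∩ a₂)) (b ∩ (a₁ ∩ a₃)) (b ∩ (a₂ ∩ a₃))
        bases = adapted-bases configuration

        open Configuration triangle using (L₁₂-sub; L₁₃-sub; L₂₃-sub)
        open AdaptedBases bases

        U-sub : IsSubspace (⟨_,_,_⟩ (a₁ ∩ a₂) (a₁ ∩ a₃) (a₂ ∩ a₃))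
        U-sub = ⟨,,⟩-isSubspace L₁₂-sub L₁₃-sub L₂₃-sub

        b∩U-sub : IsSubspace (b ∩ ⟨_,_,_⟩ (a₁ ∩ a₂) (a₁ ∩ a₃) (a₂ ∩ a₃))
        b∩U-sub = ∩-isSubspace (sub yb) U-sub

        b∩U? : U.Decidable (b ∩ ⟨_,_,_⟩ (a₁ ∩ a₂) (a₁ ∩ a₃) (a₂ ∩ a₃))
        b∩U? = dec yb ∩? HasDim⇒Decidable U-sub (_ , Triangle.U-basis y₁ y₂ y₃)

        cut-basis : IsBasis (⟨_,_,_⟩ (b ∩ (a₁ ∩ a₂)) (b ∩ (a₁ ∩ a₃)) (b ∩ (a₂ ∩ a₃))) (e₂₃ ++ (e₁₃ ++ (e₁₂ ++ z)))
        cut-basis = ⟨,,⟩-adapted-basis configuration bases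

        cut-⊆ : ⟨_,_,_⟩ (b ∩ (a₁ ∩ a₂)) (b ∩ (a₁ ∩ a₃)) (b ∩ (a₂ ∩ a₃)) ⊆ (b ∩ ⟨_,_,_⟩ (a₁ ∩ a₂) (a₁ ∩ a₃) (a₂ ∩ a₃))
        cut-⊆ = ⟨,,⟩-least b∩U-sub (λ x → map₂ (⊆-⟨,,⟩₁ L₁₂-sub L₁₃-sub L₂₃-sub x))
                                   (λ x → map₂ (⊆-⟨,,⟩₂ L₁₂-sub L₁₃-sub L₂₃-sub x))
                                   (λ x → map₂ (⊆-⟨,,⟩₃ L₁₂-sub L₁₃-sub L₂₃-sub x))

      alternative : 2 * (h * 2) ≤ d →
                    DimAtLeast (b ∩ ⟨_,_,_⟩ (a₁ ∩ a₂) (a₁ ∩ a₃) (a₂ ∩ a₃)) (d ∸ h)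
                    ⊎ DimGreater (b ∩ ((a₁ ∩ a₂) ∩ a₃)) (d ∸ 2 * (h * 2))
      alternative 4h≤d with p ≤? d ∸ 2 * (h * 2)
      ... | no p≰ = inj₂ (p , (z , R-basis) , ≰⇒> p≰)
      ... | yes p≤ = inj₁ (independent⇒DimAtLeast b∩U-sub b∩U? (e₂₃ ++ (e₁₃ ++ (e₁₂ ++ z)))
                             (λ i → cut-⊆ _ (proj₁ cut-basis i)) (proj₁ (proj₂ cut-basis))
                             (d∸h≤ {p} {m₁₂} {m₁₃} {m₂₃} (m≤o∸n⇒m+n≤o p 4h≤d p≤)
                                   (triangle-bound yb y₁ y₂ (_ , L₁₂-basis)) (triangle-bound yb y₁ y₃ (_ , L₁₃-basis))
                                   (triangle-bound yb y₂ y₃ (_ , L₂₃-basis))))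

open import Data.Nat using (ℕ; _+_; _*_; _∸_; _/_; _≤_; _<_; nonZero)
open import Data.Nat.Divisibility using (_∣_; divides)
open import Data.Nat.DivMod using (m*n/n≡m)
open import Data.Product using (_×_)
import Data.Product as Product
open import Data.Sum using (_⊎_)
open import Relation.Binary.PropositionalEquality using (refl)

lemma4p3 : (F : FiniteField) (n : ℕ) → let open Over F n in
  (𝒫 : PolarSpace) (d t : ℕ) → HasRank 𝒫 d → 2 < d →
  2 ∣ t → 2 * t ≤ d →
  (Y : Subspace → Set) → IsEKR 𝒫 d t Y →
  (a₁ a₂ a₃ : Subspace) → Y a₁ → Y a₂ → Y a₃ →
  let ℓ₁₂ = a₁ ∩ a₂
      ℓ₁₃ = a₁ ∩ a₃
      ℓ₂₃ = a₂ ∩ a₃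
      P = (a₁ ∩ a₂) ∩ a₃
      U = ⟨ ℓ₁₂ , ℓ₁₃ , ℓ₂₃ ⟩
  in DimAtLeast P (d ∸ 3 * (t / 2))
     × (HasDim P (d ∸ 3 * (t / 2)) →
          HasDim U d
        × (HasDim ℓ₁₂ (d ∸ t) × HasDim ℓ₁₃ (d ∸ t) × HasDim ℓ₂₃ (d ∸ t))
        × ((HasDim (a₁ ∩ U) (d ∸ t / 2) × (a₁ ∩ U) ≐ ⟨ ℓ₁₂ , ℓ₁₃ ⟩)
           × (HasDim (a₂ ∩ U) (d ∸ t / 2) × (a₂ ∩ U) ≐ ⟨ ℓ₁₂ , ℓ₂₃ ⟩)
           × (HasDim (a₃ ∩ U) (d ∸ t / 2) × (a₃ ∩ U) ≐ ⟨ ℓ₁₃ , ℓ₂₃ ⟩))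
        × (∀ b → Y b →
             DimAtLeast (b ∩ U) (d ∸ t / 2) ⊎ DimGreater (b ∩ P) (d ∸ 2 * t)))
lemma4p3 F n 𝒫 d t rank _ (divides h refl) 4h≤d Y ekr a₁ a₂ a₃ y₁ y₂ y₃ rewrite m*n/n≡m h 2 ⦃ nonZero ⦄ =
  P-dim-lower , λ P-dim → let open Extremal P-dim 4h≤d in
      U-dim
    , (ℓ₁₂-dim , ℓ₁₃-dim , ℓ₂₃-dim)
    , ((a₁∩U-dim , a₁∩U≐) , (a₂∩U-dim , a₂∩U≐) , (a₃∩U-dim , a₃∩U≐))
    , λ b yb → Cut.alternative 𝒫 {h = h} rank ekr y₁ y₂ y₃ yb 4h≤d
  where
  open Product using (_,_)
  open EKRTriangles F n
  open Triangle 𝒫 {h = h} rank ekr y₁ y₂ y₃
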